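{- Let $F$ be a field, $1\le v\le n$, let $C_0\subseteq F^n$ be an MDS code of dimension $k$, let $t\ge0$ be an integer, and let $C\subseteq F^{J(n,v)}$ be the span of the vectors $\pi(M)$ over all $v\times n$ matrices $M$ over $F$ having at least $t$ rows belonging to $C_0$. Then $C$ is a Johnson graph code $JGC(n,v,k,r)$ with $r=\min(v,k)-t$.
   Context: $E=\{0,\dots,n-1\}$; $J(n,v)$ is the set of $v$-element subsets of $E$. For a $v\times n$ matrix $M$ and $L\in J(n,v)$, $M_L$ is the $v\times v$ submatrix with columns in $L$, and $\pi(M)=(\det M_L)_{L\in J(n,v)}$. An MDS code of length $n$ and dimension $k$ is one in which every $k$ coordinates form an information set. For $A\subseteq E$, $B_r(A)=\{L\in J(n,v):\min(|L\setminus A|,|A\setminus L|)\le r\}$. A Johnson graph code $JGC(n,v,k,r)$ is a linear code of length $\binom nv$ with coordinates indexed by $J(n,v)$, of dimension $|B_r(A)|$ for $|A|=k$ (a number depending only on $k,r$), such that for every $k$-subset $A\subseteq E$ the coordinate set $B_r(A)$ is an information set (i.e. $|B_r(A)|=\dim C$ and restriction of codewords to $B_r(A)$ is bijective). -}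

module Defs where

open import Level using (Level; _⊔_) renaming (suc to lsuc)
open import Data.Nat as ℕ using (ℕ; zero; suc; _⊓_)
open import Data.Integer as ℤ using (ℤ; +_)
open import Data.Fin using (Fin; zero; suc; punchIn)
open import Data.Fin.Subset using (Subset; inside; outside; ∣_∣; _─_; _∈_)
open import Data.Vec as Vec using (Vec; []; _∷_; lookup)
open import Data.Product using (Σ; ∃; _×_; _,_)
open import Function.Definitions using (Injective)
open import Relation.Binary.PropositionalEquality using (_≡_; subst)
open import Relation.Nullary using (¬_)
open import Algebra.Bundles using (CommutativeRing)

record Field (c ℓ : Level) : Set (lsuc (c ⊔ ℓ)) where
  field
    commutativeRing : CommutativeRing c ℓ
  open CommutativeRing commutativeRing public
  field
    0≉1     : ¬ (0# ≈ 1#)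
    inverse : ∀ x → ¬ (x ≈ 0#) → ∃ λ y → x * y ≈ 1#

elems : ∀ {n} (L : Subset n) → Vec (Fin n) ∣ L ∣
elems [] = []
elems (inside ∷ p) = zero ∷ Vec.map suc (elems p)
elems (outside ∷ p) = Vec.map suc (elems p)

J : ℕ → ℕ → Set
J n v = Σ (Subset n) (λ L → ∣ L ∣ ≡ v)

InBall : ∀ {n} → ℤ → Subset n → Subset n → Set
InBall r A L = (+ (∣ L ─ A ∣ ⊓ ∣ A ─ L ∣)) ℤ.≤ r

module LinAlg {c ℓ} (F : Field c ℓ) where
  open Field F using (Carrier; _≈_; _+_; _*_; -_; 0#; 1#)

  Vector : ∀ {a} → Set a → Set (c ⊔ a)
  Vector I = I → Carrier

  sumFin : ∀ {m} → (Fin m → Carrier) → Carrier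
  sumFin {zero} f = 0#
  sumFin {suc m} f = f zero + sumFin (λ i → f (suc i))

  sign : ∀ {m} → Fin m → Carrier
  sign zero = 1#
  sign (suc j) = - sign j

  det : ∀ {m} → (Fin m → Fin m → Carrier) → Carrier
  det {zero} A = 1#
  det {suc m} A = sumFin (λ j → sign j * (A zero j * det (λ i j′ → A (suc i) (punchIn j j′))))

  Matrix : ℕ → ℕ → Set c
  Matrix v n = Fin v → Fin n → Carrier

  submatrix : ∀ {v n} → Matrix v n → J n v → Fin v → Fin v → Carrier
  submatrix {v} {n} M (L , eq) i j = M i (lookup (subst (Vec (Fin n)) eq (elems L)) j)

  π : ∀ {v n} → Matrix v n → Vector (J n v)
  π M L = det (submatrix M L)

  IsSubspace : ∀ {a p} {I : Set a} → (Vector I → Set p) → Set (c ⊔ ℓ ⊔ a ⊔ p)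
  IsSubspace {I = I} C =
    (∀ x y → C x → (∀ i → x i ≈ y i) → C y) ×
    C (λ _ → 0#) ×
    (∀ x y → C x → C y → C (λ i → x i + y i)) ×
    (∀ a x → C x → C (λ i → a * x i))

  HasDimension : ∀ {p} {n : ℕ} → (Vector (Fin n) → Set p) → ℕ → Set (c ⊔ ℓ ⊔ p)
  HasDimension {n = n} C k = Σ (Fin k → Vector (Fin n)) λ b →
    (∀ i → C (b i)) ×
    (∀ (a : Fin k → Carrier) → (∀ j → sumFin (λ i → a i * b i j) ≈ 0#) → ∀ i → a i ≈ 0#) ×
    (∀ x → C x → ∃ λ (a : Fin k → Carrier) → ∀ j → x j ≈ sumFin (λ i → a i * b i j))

  IsInformationSet : ∀ {a p q} {I : Set a} → (Vector I → Set p) → (I → Set q) → Set (c ⊔ ℓ ⊔ a ⊔ p ⊔ q)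
  IsInformationSet {I = I} C B =
    (∀ x y → C x → C y → (∀ i → B i → x i ≈ y i) → ∀ i → x i ≈ y i) ×
    (∀ (f : Vector I) → ∃ λ x → C x × (∀ i → B i → x i ≈ f i))

  IsMDS : ∀ {p} {n : ℕ} → (Vector (Fin n) → Set p) → ℕ → Set (c ⊔ ℓ ⊔ p)
  IsMDS {n = n} C k =
    IsSubspace C × HasDimension C k ×
    (∀ (A : Subset n) → ∣ A ∣ ≡ k → IsInformationSet C (λ i → i ∈ A))

  IsJGC : ∀ {p} (n v k : ℕ) (r : ℤ) → (Vector (J n v) → Set p) → Set (c ⊔ ℓ ⊔ p)
  IsJGC n v k r C =
    IsSubspace C ×
    (∀ (A : Subset n) → ∣ A ∣ ≡ k → IsInformationSet C (λ L → InBall r A (Data.Product.proj₁ L)))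

  AtLeastRowsIn : ∀ {p v n} → (Vector (Fin n) → Set p) → ℕ → Matrix v n → Set p
  AtLeastRowsIn {v = v} C₀ t M =
    Σ (Fin t → Fin v) λ σ → Injective _≡_ _≡_ σ × (∀ j → C₀ (M (σ j)))

  SpanDets : ∀ {p n} (v : ℕ) → (Vector (Fin n) → Set p) → ℕ → Vector (J n v) → Set (c ⊔ ℓ ⊔ p)
  SpanDets {n = n} v C₀ t x =
    Σ ℕ λ m → Σ (Fin m → Carrier) λ a → Σ (Fin m → Matrix v n) λ Ms →
      (∀ i → AtLeastRowsIn C₀ t (Ms i)) ×
      (∀ L → x L ≈ sumFin (λ i → a i * π (Ms i) L))

-- Work in the exterior algebra of Fⁿ, in the coordinates e_L (L ⊆ E), where π(M) is the wedge
-- product of the rows of M.  Fix A with |A| = k.  As A is an information set of C₀, there are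
-- codewords g_i agreeing with the unit vector δ_i on A; the vectors u_i = g_i (i ∈ A) and
-- u_i = δ_i (i ∉ A) form a basis of Fⁿ, and W_K = u_{k₁} ∧ … ∧ u_{kᵣ} agrees with e_K in every
-- coordinate L with |A ∩ L| ≥ |A ∩ K|.  A codeword of C₀ is a combination of the u_i with i ∈ A
-- alone, so wedging with it raises the A-degree |A ∩ ·|; hence C is the span of the W_K with
-- |K| = v and |A ∩ K| ≥ t.  By the unitriangularity, the coordinates L with |A ∩ L| ≥ t form an
-- information set of this span, and these L are exactly the ball B_r(A), because
-- min(|L ∖ A|, |A ∖ L|) = min(v, k) − |A ∩ L|.

module Submission where

open import Defs
open import Level using (Level; _⊔_)
open import Data.Nat as ℕ using (ℕ; zero; suc; _≤_; _<_; _⊓_; z≤n; s≤s)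
open import Data.Fin using (Fin)
import Data.Nat.Properties as ℕ
import Data.Integer as ℤ
import Data.Integer.Properties as ℤ
open import Data.Fin as Fin using (zero; suc; punchIn; punchOut; cast; splitAt)
import Data.Fin.Properties as Fin
open import Data.Fin.Subset using (Subset; inside; outside; ∣_∣; _∩_; _─_; _∈_; _∉_; ⊥; ⁅_⁆)
open import Data.Fin.Subset.Properties using (∩-zeroʳ; ∣⊥∣≡0; ∣p∣≤n; drop-there; _∈?_)
open import Data.Bool using (if_then_else_)
open import Data.Vec as Vec using (Vec; []; _∷_; here; there; lookup; _[_]≔_)
import Data.Vec.Properties as VecP
open import Data.Vec.Functional using (tail; _++_)
open import Data.Vec.Functional.Relation.Unary.All.Properties using (++⁺)
open import Data.Product using (Σ; ∃; _×_; _,_; proj₁; proj₂)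
open import Data.Sum using (_⊎_; inj₁; inj₂)
open import Data.Sum.Properties using ([,]-map)
open import Data.Empty using (⊥-elim)
open import Data.Maybe using (nothing)
open import Function using (_∘_; _⇔_; mk⇔; Equivalence)
open import Function.Definitions using (Injective)
open import Relation.Nullary using (Dec; yes; no; does; ¬_; contradiction)
open import Relation.Nullary.Decidable using (_×-dec_)
open import Relation.Binary.PropositionalEquality as ≡ using (_≡_; _≢_)
open import Algebra.Bundles using (CommutativeRing)
open import Tactic.RingSolver.Core.AlmostCommutativeRing using (fromCommutativeRing)

count-down : ∀ {p} (P : ℕ → Set p) {b} → P b → (∀ s → P (suc s) → P s) → P 0
count-down P {zero}  P-b step = P-b
count-down P {suc b} P-b step = count-down P (step b P-b) step

∣A∩⊥∣≡0 : ∀ {n} (A : Subset n) → ∣ A ∩ ⊥ ∣ ≡ 0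
∣A∩⊥∣≡0 {n} A = ≡.trans (≡.cong ∣_∣ (∩-zeroʳ A)) (∣⊥∣≡0 n)

∣A∩⁅i⁆∣≡1 : ∀ {n} {A : Subset n} {i} → i ∈ A → ∣ A ∩ ⁅ i ⁆ ∣ ≡ 1
∣A∩⁅i⁆∣≡1 {A = inside ∷ A}  here      = ≡.cong suc (∣A∩⊥∣≡0 A)
∣A∩⁅i⁆∣≡1 {A = inside ∷ A}  (there p) = ∣A∩⁅i⁆∣≡1 p
∣A∩⁅i⁆∣≡1 {A = outside ∷ A} (there p) = ∣A∩⁅i⁆∣≡1 p

∣A∩⁅i⁆∣≡0 : ∀ {n} {A : Subset n} {i} → i ∉ A → ∣ A ∩ ⁅ i ⁆ ∣ ≡ 0
∣A∩⁅i⁆∣≡0 {A = inside ∷ A}  {zero}  i∉A = ⊥-elim (i∉A here)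
∣A∩⁅i⁆∣≡0 {A = outside ∷ A} {zero}  i∉A = ∣A∩⊥∣≡0 A
∣A∩⁅i⁆∣≡0 {A = inside ∷ A}  {suc i} i∉A = ∣A∩⁅i⁆∣≡0 (i∉A ∘ there)
∣A∩⁅i⁆∣≡0 {A = outside ∷ A} {suc i} i∉A = ∣A∩⁅i⁆∣≡0 (i∉A ∘ there)

∣insert∣ : ∀ {m} {i : Fin m} {K} → i ∉ K → ∣ K [ i ]≔ inside ∣ ≡ suc ∣ K ∣
∣insert∣ {i = zero}  {inside ∷ K}  i∉K = ⊥-elim (i∉K here)
∣insert∣ {i = zero}  {outside ∷ K} i∉K = ≡.refl
∣insert∣ {i = suc i} {inside ∷ K}  i∉K = ≡.cong suc (∣insert∣ (i∉K ∘ there))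
∣insert∣ {i = suc i} {outside ∷ K} i∉K = ∣insert∣ (i∉K ∘ there)

∣A∩insert∣ : ∀ {m} (A : Subset m) {i K} → i ∉ K → ∣ A ∩ (K [ i ]≔ inside) ∣ ≡ ∣ A ∩ ⁅ i ⁆ ∣ ℕ.+ ∣ A ∩ K ∣
∣A∩insert∣ (a ∷ A)       {zero}  {inside ∷ K}  i∉K = ⊥-elim (i∉K here)
∣A∩insert∣ (inside ∷ A)  {zero}  {outside ∷ K} i∉K rewrite ∣A∩⊥∣≡0 A = ≡.refl
∣A∩insert∣ (outside ∷ A) {zero}  {outside ∷ K} i∉K rewrite ∣A∩⊥∣≡0 A = ≡.refl
∣A∩insert∣ (inside ∷ A)  {suc i} {inside ∷ K}  i∉K =
  ≡.trans (≡.cong suc (∣A∩insert∣ A (i∉K ∘ there))) (≡.sym (ℕ.+-suc _ _))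
∣A∩insert∣ (inside ∷ A)  {suc i} {outside ∷ K} i∉K = ∣A∩insert∣ A (i∉K ∘ there)
∣A∩insert∣ (outside ∷ A) {suc i} {inside ∷ K}  i∉K = ∣A∩insert∣ A (i∉K ∘ there)
∣A∩insert∣ (outside ∷ A) {suc i} {outside ∷ K} i∉K = ∣A∩insert∣ A (i∉K ∘ there)

∉-there : ∀ {m} {i : Fin m} {b K} → i ∉ K → suc i ∉ b ∷ K
∉-there i∉K = i∉K ∘ drop-there

delete : ∀ {n} (L : Subset n) → Fin ∣ L ∣ → Subset n
delete (inside ∷ L)  zero    = outside ∷ L
delete (inside ∷ L)  (suc j) = inside ∷ delete L j
delete (outside ∷ L) j       = outside ∷ delete L j

∣L─A∣+∣A∩L∣≡∣L∣ : ∀ {n} (A L : Subset n) → ∣ L ─ A ∣ ℕ.+ ∣ A ∩ L ∣ ≡ ∣ L ∣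
∣L─A∣+∣A∩L∣≡∣L∣ []            []            = ≡.refl
∣L─A∣+∣A∩L∣≡∣L∣ (inside ∷ A)  (inside ∷ L)  = ≡.trans (ℕ.+-suc _ _) (≡.cong suc (∣L─A∣+∣A∩L∣≡∣L∣ A L))
∣L─A∣+∣A∩L∣≡∣L∣ (inside ∷ A)  (outside ∷ L) = ∣L─A∣+∣A∩L∣≡∣L∣ A L
∣L─A∣+∣A∩L∣≡∣L∣ (outside ∷ A) (inside ∷ L)  = ≡.cong suc (∣L─A∣+∣A∩L∣≡∣L∣ A L)
∣L─A∣+∣A∩L∣≡∣L∣ (outside ∷ A) (outside ∷ L) = ∣L─A∣+∣A∩L∣≡∣L∣ A L

∣A─L∣+∣A∩L∣≡∣A∣ : ∀ {n} (A L : Subset n) → ∣ A ─ L ∣ ℕ.+ ∣ A ∩ L ∣ ≡ ∣ A ∣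
∣A─L∣+∣A∩L∣≡∣A∣ []            []            = ≡.refl
∣A─L∣+∣A∩L∣≡∣A∣ (inside ∷ A)  (inside ∷ L)  = ≡.trans (ℕ.+-suc _ _) (≡.cong suc (∣A─L∣+∣A∩L∣≡∣A∣ A L))
∣A─L∣+∣A∩L∣≡∣A∣ (inside ∷ A)  (outside ∷ L) = ≡.cong suc (∣A─L∣+∣A∩L∣≡∣A∣ A L)
∣A─L∣+∣A∩L∣≡∣A∣ (outside ∷ A) (inside ∷ L)  = ∣A─L∣+∣A∩L∣≡∣A∣ A L
∣A─L∣+∣A∩L∣≡∣A∣ (outside ∷ A) (outside ∷ L) = ∣A─L∣+∣A∩L∣≡∣A∣ A L

there-suc : ∀ {n} {a} {A : Subset n} K {p} → lookup (elems K) p ∈ A → lookup (Vec.map suc (elems K)) p ∈ a ∷ A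
there-suc K {p} ∈A = ≡.subst (_∈ _) (≡.sym (VecP.lookup-map p suc (elems K))) (there ∈A)

positions : ∀ {n} (A K : Subset n) → Fin ∣ A ∩ K ∣ → Fin ∣ K ∣
positions []            []            ()
positions (inside ∷ A)  (inside ∷ K)  zero    = zero
positions (inside ∷ A)  (inside ∷ K)  (suc j) = suc (positions A K j)
positions (inside ∷ A)  (outside ∷ K) j       = positions A K j
positions (outside ∷ A) (inside ∷ K)  j       = suc (positions A K j)
positions (outside ∷ A) (outside ∷ K) j       = positions A K j

positions-∈ : ∀ {n} (A K : Subset n) j → lookup (elems K) (positions A K j) ∈ A
positions-∈ []            []            ()
positions-∈ (inside ∷ A)  (inside ∷ K)  zero    = here
positions-∈ (inside ∷ A)  (inside ∷ K)  (suc j) = there-suc K (positions-∈ A K j)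
positions-∈ (inside ∷ A)  (outside ∷ K) j       = there-suc K (positions-∈ A K j)
positions-∈ (outside ∷ A) (inside ∷ K)  j       = there-suc K (positions-∈ A K j)
positions-∈ (outside ∷ A) (outside ∷ K) j       = there-suc K (positions-∈ A K j)

positions-injective : ∀ {n} (A K : Subset n) → Injective _≡_ _≡_ (positions A K)
positions-injective []            []            {()}
positions-injective (inside ∷ A)  (inside ∷ K)  {zero}  {zero}  _  = ≡.refl
positions-injective (inside ∷ A)  (inside ∷ K)  {zero}  {suc j} ()
positions-injective (inside ∷ A)  (inside ∷ K)  {suc i} {zero}  ()
positions-injective (inside ∷ A)  (inside ∷ K)  {suc i} {suc j} eq =
  ≡.cong suc (positions-injective A K (Fin.suc-injective eq))
positions-injective (inside ∷ A)  (outside ∷ K) eq = positions-injective A K eq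
positions-injective (outside ∷ A) (inside ∷ K)  eq = positions-injective A K (Fin.suc-injective eq)
positions-injective (outside ∷ A) (outside ∷ K) eq = positions-injective A K eq

module ExteriorAlgebra {c ℓ} (R : CommutativeRing c ℓ) where
  open CommutativeRing R hiding (zero)
  open import Algebra.Properties.Ring ring
    using (-0#≈0#; -‿distribˡ-*; -‿+-comm; -1*x≈-x; x[y-z]≈xy-xz; +-inverseˡ-unique; x∙y⁻¹≈ε⇒x≈y; x≈y⇒x∙y⁻¹≈ε)
  open import Algebra.Properties.Semiring.Sum semiring using (sum; sum-cong-≋; sum-replicate-zero; ∑-distrib-+)
  open import Algebra.Properties.CommutativeSemigroup +-commutativeSemigroup
    using () renaming (interchange to +-interchange)
  open import Algebra.Properties.CommutativeSemigroup *-commutativeSemigroup using (x∙yz≈y∙xz)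
  open import Tactic.RingSolver.NonReflective (fromCommutativeRing R (λ _ → nothing))
    using (solve; _⊜_) renaming (_⊕_ to infixl 6 _:+_; _⊗_ to infixl 7 _:*_; ⊝_ to infix 8 :-_)
  open import Relation.Binary.Reasoning.Setoid setoid

  module _ {a} {I : Set a} where
    infix 4 _≋_
    infixl 6 _⊕_ _⊖_
    infixr 7 _·_
    infix 8 ⊝_

    _≋_ : (I → Carrier) → (I → Carrier) → Set (a ⊔ ℓ)
    x ≋ y = ∀ i → x i ≈ y i

    𝟎 : I → Carrier
    𝟎 _ = 0#

    _⊕_ _⊖_ : (I → Carrier) → (I → Carrier) → I → Carrier
    (x ⊕ y) i = x i + y i
    (x ⊖ y) i = x i - y i

    ⊝_ : (I → Carrier) → I → Carrier
    (⊝ x) i = - x i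

    _·_ : Carrier → (I → Carrier) → I → Carrier
    (s · x) i = s * x i

  x-0≈x : ∀ x → x - 0# ≈ x
  x-0≈x x = trans (+-congˡ -0#≈0#) (+-identityʳ x)

  y+[x-y]≈x : ∀ x y → y + (x - y) ≈ x
  y+[x-y]≈x x y = begin
    y + (x - y)    ≈⟨ +-comm y (x - y) ⟩
    x - y + y      ≈⟨ +-assoc x (- y) y ⟩
    x + (- y + y)  ≈⟨ +-congˡ (-‿inverseˡ y) ⟩
    x + 0#         ≈⟨ +-identityʳ x ⟩
    x              ∎

  V : ℕ → Set c
  V n = Fin n → Carrier

  δ : ∀ {n} → Fin n → V n
  δ zero    zero    = 1#
  δ zero    (suc j) = 0#
  δ (suc i) zero    = 0#
  δ (suc i) (suc j) = δ i j

  δ-offdiag : ∀ {n} {i j : Fin n} → i ≢ j → δ i j ≈ 0#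
  δ-offdiag {i = zero}  {zero}  i≢j = ⊥-elim (i≢j ≡.refl)
  δ-offdiag {i = zero}  {suc j} i≢j = refl
  δ-offdiag {i = suc i} {zero}  i≢j = refl
  δ-offdiag {i = suc i} {suc j} i≢j = δ-offdiag (i≢j ∘ ≡.cong suc)

  sum-zero : ∀ {m} {f : V m} → f ≋ 𝟎 → sum f ≈ 0#
  sum-zero {m} f≋0 = trans (sum-cong-≋ f≋0) (sum-replicate-zero m)

  sum-δ : ∀ {m} (f : V m) j → sum (λ i → f i * δ i j) ≈ f j
  sum-δ {suc m} f zero = begin
    f zero * 1# + sum (λ i → f (suc i) * 0#) ≈⟨ +-cong (*-identityʳ _) (sum-zero {m} (λ i → zeroʳ (f (suc i)))) ⟩
    f zero + 0#                               ≈⟨ +-identityʳ _ ⟩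
    f zero                                    ∎
  sum-δ {suc m} f (suc j) = begin
    f zero * 0# + sum (λ i → f (suc i) * δ i j) ≈⟨ +-cong (zeroʳ _) (sum-δ (f ∘ suc) j) ⟩
    0# + f (suc j)                              ≈⟨ +-identityˡ _ ⟩
    f (suc j)                                   ∎

  sum-neg : ∀ {m} (f : V m) → sum (⊝ f) ≈ - sum f
  sum-neg {zero}  f = sym -0#≈0#
  sum-neg {suc m} f = trans (+-congˡ (sum-neg (f ∘ suc))) (-‿+-comm (f zero) _)

  sum-++ : ∀ {a} {X : Set a} {m₁ m₂} (h : X → Carrier) (xs : Fin m₁ → X) (ys : Fin m₂ → X) →
           sum (h ∘ (xs ++ ys)) ≈ sum (h ∘ xs) + sum (h ∘ ys)
  sum-++ {m₁ = zero}   h xs ys = sym (+-identityˡ _)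
  sum-++ {m₁ = suc m₁} h xs ys = begin
    h (xs zero) + sum (h ∘ (xs ++ ys) ∘ suc)
      ≈⟨ +-congˡ (sum-cong-≋ λ i → reflexive (≡.cong h ([,]-map (splitAt m₁ i)))) ⟩
    h (xs zero) + sum (h ∘ ((xs ∘ suc) ++ ys))           ≈⟨ +-congˡ (sum-++ h (xs ∘ suc) ys) ⟩
    h (xs zero) + (sum (h ∘ xs ∘ suc) + sum (h ∘ ys))    ≈⟨ +-assoc _ _ _ ⟨
    h (xs zero) + sum (h ∘ xs ∘ suc) + sum (h ∘ ys)      ∎

  -- Coordinates in the basis e_L = e_{l₁} ∧ … ∧ e_{lᵣ} (L = {l₁ < … < lᵣ}) of the exterior algebra of Rⁿ.
  Λ : ℕ → Set c
  Λ n = Subset n → Carrier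

  e : ∀ {n} → Subset n → Λ n
  e []            []            = 1#
  e (inside ∷ K)  (inside ∷ L)  = e K L
  e (inside ∷ K)  (outside ∷ L) = 0#
  e (outside ∷ K) (inside ∷ L)  = 0#
  e (outside ∷ K) (outside ∷ L) = e K L

  e-diag : ∀ {n} (K : Subset n) → e K K ≈ 1#
  e-diag []            = refl
  e-diag (inside ∷ K)  = e-diag K
  e-diag (outside ∷ K) = e-diag K

  e-offdiag : ∀ {n} {K L : Subset n} → K ≢ L → e K L ≈ 0#
  e-offdiag {K = []}          {[]}          K≢L = ⊥-elim (K≢L ≡.refl)
  e-offdiag {K = inside ∷ K}  {inside ∷ L}  K≢L = e-offdiag (K≢L ∘ ≡.cong (inside ∷_))
  e-offdiag {K = inside ∷ K}  {outside ∷ L} K≢L = refl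
  e-offdiag {K = outside ∷ K} {inside ∷ L}  K≢L = refl
  e-offdiag {K = outside ∷ K} {outside ∷ L} K≢L = e-offdiag (K≢L ∘ ≡.cong (outside ∷_))

  e⊥-at-empty : ∀ {n} (L : Subset n) → ∣ L ∣ ≡ 0 → e ⊥ L ≈ 1#
  e⊥-at-empty []            _      = refl
  e⊥-at-empty (outside ∷ L) ∣L∣≡0 = e⊥-at-empty L ∣L∣≡0

  ∑ₛ : ∀ {n} → Λ n → Carrier
  ∑ₛ {zero}  f = f []
  ∑ₛ {suc n} f = ∑ₛ (f ∘ (inside ∷_)) + ∑ₛ (f ∘ (outside ∷_))

  ∑ₛ-cong : ∀ {n} {f g : Λ n} → f ≋ g → ∑ₛ f ≈ ∑ₛ g
  ∑ₛ-cong {zero}  f≋g = f≋g []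
  ∑ₛ-cong {suc n} f≋g = +-cong (∑ₛ-cong (f≋g ∘ (inside ∷_))) (∑ₛ-cong (f≋g ∘ (outside ∷_)))

  ∑ₛ-distrib-+ : ∀ {n} (f g : Λ n) → ∑ₛ (f ⊕ g) ≈ ∑ₛ f + ∑ₛ g
  ∑ₛ-distrib-+ {zero}  f g = refl
  ∑ₛ-distrib-+ {suc n} f g = begin
    ∑ₛ (fᵢ ⊕ gᵢ) + ∑ₛ (fₒ ⊕ gₒ)         ≈⟨ +-cong (∑ₛ-distrib-+ fᵢ gᵢ) (∑ₛ-distrib-+ fₒ gₒ) ⟩
    (∑ₛ fᵢ + ∑ₛ gᵢ) + (∑ₛ fₒ + ∑ₛ gₒ)   ≈⟨ +-interchange _ _ _ _ ⟩
    (∑ₛ fᵢ + ∑ₛ fₒ) + (∑ₛ gᵢ + ∑ₛ gₒ)   ∎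
    where
    fᵢ fₒ gᵢ gₒ : Λ n
    fᵢ = f ∘ (inside ∷_)
    fₒ = f ∘ (outside ∷_)
    gᵢ = g ∘ (inside ∷_)
    gₒ = g ∘ (outside ∷_)

  *-distribˡ-∑ₛ : ∀ {n} s (f : Λ n) → ∑ₛ (s · f) ≈ s * ∑ₛ f
  *-distribˡ-∑ₛ {zero}  s f = refl
  *-distribˡ-∑ₛ {suc n} s f =
    trans (+-cong (*-distribˡ-∑ₛ s (f ∘ (inside ∷_))) (*-distribˡ-∑ₛ s (f ∘ (outside ∷_)))) (sym (distribˡ s _ _))

  ∑ₛ-zero : ∀ {n} {f : Λ n} → f ≋ 𝟎 → ∑ₛ f ≈ 0#
  ∑ₛ-zero {zero}  f≋0 = f≋0 []
  ∑ₛ-zero {suc n} f≋0 =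
    trans (+-cong (∑ₛ-zero (f≋0 ∘ (inside ∷_))) (∑ₛ-zero (f≋0 ∘ (outside ∷_)))) (+-identityʳ 0#)

  ∑ₛ-single : ∀ {n} (f : Λ n) K → (∀ L → L ≢ K → f L ≈ 0#) → ∑ₛ f ≈ f K
  ∑ₛ-single {zero}  f []            f≈0 = refl
  ∑ₛ-single {suc n} f (inside ∷ K)  f≈0 = begin
    ∑ₛ (f ∘ (inside ∷_)) + ∑ₛ (f ∘ (outside ∷_))
      ≈⟨ +-cong (∑ₛ-single _ K (λ L L≢K → f≈0 _ (L≢K ∘ ≡.cong Vec.tail)))
                (∑ₛ-zero {f = f ∘ (outside ∷_)} (λ L → f≈0 _ λ ())) ⟩
    f (inside ∷ K) + 0#  ≈⟨ +-identityʳ _ ⟩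
    f (inside ∷ K)       ∎
  ∑ₛ-single {suc n} f (outside ∷ K) f≈0 = begin
    ∑ₛ (f ∘ (inside ∷_)) + ∑ₛ (f ∘ (outside ∷_))
      ≈⟨ +-cong (∑ₛ-zero {f = f ∘ (inside ∷_)} (λ L → f≈0 _ λ ()))
                (∑ₛ-single _ K (λ L L≢K → f≈0 _ (L≢K ∘ ≡.cong Vec.tail))) ⟩
    0# + f (outside ∷ K)  ≈⟨ +-identityˡ _ ⟩
    f (outside ∷ K)       ∎

  -- w ∧ y splits off the first basis vector; the sign comes from moving e₀ past tail w.
  infixr 8 _∧_
  _∧_ : ∀ {n} → V n → Λ n → Λ n
  _∧_ {zero}  w y []            = 0#
  _∧_ {suc n} w y (inside ∷ L)  = w zero * y (outside ∷ L) - (tail w ∧ y ∘ (inside ∷_)) L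
  _∧_ {suc n} w y (outside ∷ L) = (tail w ∧ y ∘ (outside ∷_)) L

  ∧-cong : ∀ {n} {w w′ : V n} {y y′ : Λ n} → w ≋ w′ → y ≋ y′ → w ∧ y ≋ w′ ∧ y′
  ∧-cong {zero}  w≋w′ y≋y′ []            = refl
  ∧-cong {suc n} w≋w′ y≋y′ (inside ∷ L)  =
    +-cong (*-cong (w≋w′ zero) (y≋y′ _)) (-‿cong (∧-cong (w≋w′ ∘ suc) (y≋y′ ∘ (inside ∷_)) L))
  ∧-cong {suc n} w≋w′ y≋y′ (outside ∷ L) = ∧-cong (w≋w′ ∘ suc) (y≋y′ ∘ (outside ∷_)) L

  ∧-distribˡ-⊕ : ∀ {n} (w : V n) y z → w ∧ (y ⊕ z) ≋ w ∧ y ⊕ w ∧ z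
  ∧-distribˡ-⊕ {zero}  w y z []            = sym (+-identityʳ 0#)
  ∧-distribˡ-⊕ {suc n} w y z (inside ∷ L)  = begin
    w zero * (y (outside ∷ L) + z (outside ∷ L)) - (tail w ∧ (yᵢ ⊕ zᵢ)) L
      ≈⟨ +-congˡ (-‿cong (∧-distribˡ-⊕ (tail w) yᵢ zᵢ L)) ⟩
    w zero * (y (outside ∷ L) + z (outside ∷ L)) - ((tail w ∧ yᵢ) L + (tail w ∧ zᵢ) L)
      ≈⟨ solve 5 (λ a p q A B → (a :* (p :+ q) :+ :- (A :+ B)) ⊜ ((a :* p :+ :- A) :+ (a :* q :+ :- B)))
                 refl _ _ _ _ _ ⟩
    (w ∧ y) (inside ∷ L) + (w ∧ z) (inside ∷ L)  ∎
    where
    yᵢ zᵢ : Λ n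
    yᵢ = y ∘ (inside ∷_)
    zᵢ = z ∘ (inside ∷_)
  ∧-distribˡ-⊕ {suc n} w y z (outside ∷ L) = ∧-distribˡ-⊕ (tail w) _ _ L

  ∧-distribʳ-⊕ : ∀ {n} (w x : V n) y → (w ⊕ x) ∧ y ≋ w ∧ y ⊕ x ∧ y
  ∧-distribʳ-⊕ {zero}  w x y []            = sym (+-identityʳ 0#)
  ∧-distribʳ-⊕ {suc n} w x y (inside ∷ L)  = begin
    (w zero + x zero) * y (outside ∷ L) - (tail (w ⊕ x) ∧ yᵢ) L
      ≈⟨ +-congˡ (-‿cong (∧-distribʳ-⊕ (tail w) (tail x) yᵢ L)) ⟩
    (w zero + x zero) * y (outside ∷ L) - ((tail w ∧ yᵢ) L + (tail x ∧ yᵢ) L)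
      ≈⟨ solve 5 (λ a b p A B → ((a :+ b) :* p :+ :- (A :+ B)) ⊜ ((a :* p :+ :- A) :+ (b :* p :+ :- B)))
                 refl _ _ _ _ _ ⟩
    (w ∧ y) (inside ∷ L) + (x ∧ y) (inside ∷ L)  ∎
    where
    yᵢ : Λ n
    yᵢ = y ∘ (inside ∷_)
  ∧-distribʳ-⊕ {suc n} w x y (outside ∷ L) = ∧-distribʳ-⊕ (tail w) (tail x) _ L

  ∧-scaleˡ : ∀ {n} s (w : V n) y → (s · w) ∧ y ≋ s · w ∧ y
  ∧-scaleˡ {zero}  s w y []            = sym (zeroʳ s)
  ∧-scaleˡ {suc n} s w y (inside ∷ L)  = begin
    s * w zero * y (outside ∷ L) - (tail (s · w) ∧ yᵢ) L
      ≈⟨ +-congˡ (-‿cong (∧-scaleˡ s (tail w) yᵢ L)) ⟩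
    s * w zero * y (outside ∷ L) - s * (tail w ∧ yᵢ) L
      ≈⟨ +-congʳ (*-assoc s _ _) ⟩
    s * (w zero * y (outside ∷ L)) - s * (tail w ∧ yᵢ) L
      ≈⟨ x[y-z]≈xy-xz s _ _ ⟨
    s * (w ∧ y) (inside ∷ L)  ∎
    where
    yᵢ : Λ n
    yᵢ = y ∘ (inside ∷_)
  ∧-scaleˡ {suc n} s w y (outside ∷ L) = ∧-scaleˡ s (tail w) _ L

  ∧-scaleʳ : ∀ {n} s (w : V n) y → w ∧ (s · y) ≋ s · w ∧ y
  ∧-scaleʳ {zero}  s w y []            = sym (zeroʳ s)
  ∧-scaleʳ {suc n} s w y (inside ∷ L)  = begin
    w zero * (s * y (outside ∷ L)) - (tail w ∧ (s · yᵢ)) L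
      ≈⟨ +-congˡ (-‿cong (∧-scaleʳ s (tail w) yᵢ L)) ⟩
    w zero * (s * y (outside ∷ L)) - s * (tail w ∧ yᵢ) L
      ≈⟨ +-congʳ (x∙yz≈y∙xz _ s _) ⟩
    s * (w zero * y (outside ∷ L)) - s * (tail w ∧ yᵢ) L
      ≈⟨ x[y-z]≈xy-xz s _ _ ⟨
    s * (w ∧ y) (inside ∷ L)  ∎
    where
    yᵢ : Λ n
    yᵢ = y ∘ (inside ∷_)
  ∧-scaleʳ {suc n} s w y (outside ∷ L) = ∧-scaleʳ s (tail w) _ L

  ∧-zeroˡ : ∀ {n} {w : V n} y → w ≋ 𝟎 → w ∧ y ≋ 𝟎
  ∧-zeroˡ {w = w} y w≋0 L = begin
    (w ∧ y) L         ≈⟨ ∧-cong (λ j → trans (w≋0 j) (sym (zeroˡ (w j)))) (λ _ → refl) L ⟩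
    ((0# · w) ∧ y) L  ≈⟨ ∧-scaleˡ 0# w y L ⟩
    0# * (w ∧ y) L    ≈⟨ zeroˡ _ ⟩
    0#                ∎

  ∧-zeroʳ : ∀ {n} (w : V n) {y} → y ≋ 𝟎 → w ∧ y ≋ 𝟎
  ∧-zeroʳ w {y} y≋0 L = begin
    (w ∧ y) L         ≈⟨ ∧-cong (λ _ → refl) (λ K → trans (y≋0 K) (sym (zeroˡ (y K)))) L ⟩
    (w ∧ (0# · y)) L   ≈⟨ ∧-scaleʳ 0# w y L ⟩
    0# * (w ∧ y) L    ≈⟨ zeroˡ _ ⟩
    0#                ∎

  -- The ring solver cannot simplify products of negated coefficients over an abstract ring, so
  -- subtraction is handled as scaling by -1.
  ⊖≋⊕-1· : ∀ {a} {I : Set a} (y z : I → Carrier) → y ⊖ z ≋ y ⊕ (- 1#) · z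
  ⊖≋⊕-1· y z i = +-congˡ (sym (-1*x≈-x (z i)))

  ∧-distribˡ-⊖ : ∀ {n} (w : V n) y z → w ∧ (y ⊖ z) ≋ w ∧ y ⊖ w ∧ z
  ∧-distribˡ-⊖ w y z L = begin
    (w ∧ (y ⊖ z)) L                   ≈⟨ ∧-cong (λ _ → refl) (⊖≋⊕-1· y z) L ⟩
    (w ∧ (y ⊕ (- 1#) · z)) L          ≈⟨ ∧-distribˡ-⊕ w y _ L ⟩
    (w ∧ y) L + (w ∧ ((- 1#) · z)) L   ≈⟨ +-congˡ (∧-scaleʳ (- 1#) w z L) ⟩
    (w ∧ y) L + - 1# * (w ∧ z) L      ≈⟨ ⊖≋⊕-1· (w ∧ y) (w ∧ z) L ⟨
    (w ∧ y) L - (w ∧ z) L             ∎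

  ∧-distribʳ-⊖ : ∀ {n} (w x : V n) y → (w ⊖ x) ∧ y ≋ w ∧ y ⊖ x ∧ y
  ∧-distribʳ-⊖ w x y L = begin
    ((w ⊖ x) ∧ y) L                   ≈⟨ ∧-cong (⊖≋⊕-1· w x) (λ _ → refl) L ⟩
    ((w ⊕ (- 1#) · x) ∧ y) L          ≈⟨ ∧-distribʳ-⊕ w _ y L ⟩
    (w ∧ y) L + (((- 1#) · x) ∧ y) L  ≈⟨ +-congˡ (∧-scaleˡ (- 1#) x y L) ⟩
    (w ∧ y) L + - 1# * (x ∧ y) L      ≈⟨ ⊖≋⊕-1· (w ∧ y) (x ∧ y) L ⟨
    (w ∧ y) L - (x ∧ y) L             ∎

  ∧-alternating : ∀ {n} (w : V n) y → w ∧ w ∧ y ≋ 𝟎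
  ∧-alternating {zero}  w y []            = refl
  ∧-alternating {suc n} w y (inside ∷ L)  = begin
    w zero * X - (tail w ∧ (w ∧ y) ∘ (inside ∷_)) L  ≈⟨ +-congˡ (-‿cong inner) ⟩
    w zero * X - w zero * X                           ≈⟨ -‿inverseʳ _ ⟩
    0#                                                ∎
    where
    yᵢ yₒ : Λ n
    yᵢ = y ∘ (inside ∷_)
    yₒ = y ∘ (outside ∷_)
    X : Carrier
    X = (tail w ∧ yₒ) L
    inner : (tail w ∧ (w zero · yₒ ⊖ tail w ∧ yᵢ)) L ≈ w zero * X
    inner = begin
      (tail w ∧ (w zero · yₒ ⊖ tail w ∧ yᵢ)) L       ≈⟨ ∧-distribˡ-⊖ (tail w) _ _ L ⟩
      (tail w ∧ (w zero · yₒ)) L - (tail w ∧ tail w ∧ yᵢ) L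
        ≈⟨ +-cong (∧-scaleʳ (w zero) (tail w) yₒ L) (-‿cong (∧-alternating (tail w) yᵢ L)) ⟩
      w zero * X - 0#                                 ≈⟨ x-0≈x _ ⟩
      w zero * X                                      ∎
  ∧-alternating {suc n} w y (outside ∷ L) = ∧-alternating (tail w) _ L

  ∧-anticomm : ∀ {n} (w x : V n) y → w ∧ x ∧ y ≋ ⊝ (x ∧ w ∧ y)
  ∧-anticomm w x y L = +-inverseˡ-unique _ _ (begin
    (w ∧ x ∧ y) L + (x ∧ w ∧ y) L
      ≈⟨ +-cong (+-identityˡ _) (+-identityʳ _) ⟨
    (0# + (w ∧ x ∧ y) L) + ((x ∧ w ∧ y) L + 0#)
      ≈⟨ +-cong (+-congʳ (∧-alternating w y L)) (+-congˡ (∧-alternating x y L)) ⟨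
    ((w ∧ w ∧ y) L + (w ∧ x ∧ y) L) + ((x ∧ w ∧ y) L + (x ∧ x ∧ y) L)
      ≈⟨ +-cong (∧-distribˡ-⊕ w _ _ L) (∧-distribˡ-⊕ x _ _ L) ⟨
    (w ∧ (w ∧ y ⊕ x ∧ y)) L + (x ∧ (w ∧ y ⊕ x ∧ y)) L
      ≈⟨ ∧-distribʳ-⊕ w x _ L ⟨
    ((w ⊕ x) ∧ (w ∧ y ⊕ x ∧ y)) L
      ≈⟨ ∧-cong (λ _ → refl) (∧-distribʳ-⊕ w x y) L ⟨
    ((w ⊕ x) ∧ (w ⊕ x) ∧ y) L
      ≈⟨ ∧-alternating (w ⊕ x) y L ⟩
    0#  ∎)

  ∧-∑ₛ : ∀ {m n} (w : V n) (F : Subset m → Λ n) → w ∧ (λ L → ∑ₛ λ K → F K L) ≋ λ L → ∑ₛ λ K → (w ∧ F K) L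
  ∧-∑ₛ {zero}  w F L = refl
  ∧-∑ₛ {suc m} w F L = trans (∧-distribˡ-⊕ w _ _ L)
    (+-cong (∧-∑ₛ w (F ∘ (inside ∷_)) L) (∧-∑ₛ w (F ∘ (outside ∷_)) L))

  ∧-sumˡ : ∀ {m n} (f : Fin m → V n) y → (λ j → sum λ i → f i j) ∧ y ≋ λ L → sum λ i → (f i ∧ y) L
  ∧-sumˡ {zero}  f y = ∧-zeroˡ y (λ _ → refl)
  ∧-sumˡ {suc m} f y L = trans (∧-distribʳ-⊕ (f zero) _ y L) (+-congˡ (∧-sumˡ (f ∘ suc) y L))

  ⋀ : ∀ {v n} → (Fin v → V n) → Λ n
  ⋀ {zero}  M = e ⊥
  ⋀ {suc v} M = M zero ∧ ⋀ (M ∘ suc)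

  ⋀-cong : ∀ {v n} {M M′ : Fin v → V n} → (∀ i → M i ≋ M′ i) → ⋀ M ≋ ⋀ M′
  ⋀-cong {zero}  M≋M′ L = refl
  ⋀-cong {suc v} M≋M′   = ∧-cong (M≋M′ zero) (⋀-cong (M≋M′ ∘ suc))

  ⋀[_]_ : ∀ {m n} → (Fin m → V n) → Subset m → Λ n
  ⋀[ h ] []            = e ⊥
  ⋀[ h ] (inside ∷ K)  = h zero ∧ ⋀[ h ∘ suc ] K
  ⋀[ h ] (outside ∷ K) = ⋀[ h ∘ suc ] K

  ⋀-map-suc : ∀ {v m n} (h : Fin (suc m) → V n) (xs : Vec (Fin m) v) →
              ⋀ (h ∘ lookup (Vec.map suc xs)) ≋ ⋀ (h ∘ suc ∘ lookup xs)
  ⋀-map-suc h xs = ⋀-cong (λ r j → reflexive (≡.cong (λ i → h i j) (VecP.lookup-map r suc xs)))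

  ⋀-elems : ∀ {m n} (h : Fin m → V n) K → ⋀ (h ∘ lookup (elems K)) ≋ ⋀[ h ] K
  ⋀-elems h []            = λ _ → refl
  ⋀-elems h (inside ∷ K)  = ∧-cong (λ _ → refl) (λ L → trans (⋀-map-suc h (elems K) L) (⋀-elems (h ∘ suc) K L))
  ⋀-elems h (outside ∷ K) L = trans (⋀-map-suc h (elems K) L) (⋀-elems (h ∘ suc) K L)

  ⋀[]⊥≡e⊥ : ∀ {m n} (h : Fin m → V n) → ⋀[ h ] ⊥ ≡ e ⊥
  ⋀[]⊥≡e⊥ {zero}  h = ≡.refl
  ⋀[]⊥≡e⊥ {suc m} h = ⋀[]⊥≡e⊥ (h ∘ suc)

  record MinSplit {m} (K : Subset m) : Set (c ⊔ ℓ) where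
    field
      min  : Fin m
      rest : Subset m
      ∣K∣≡1+∣rest∣ : ∣ K ∣ ≡ suc ∣ rest ∣
      ∣A∩K∣≡∣A∩min∣+∣A∩rest∣ : ∀ A → ∣ A ∩ K ∣ ≡ ∣ A ∩ ⁅ min ⁆ ∣ ℕ.+ ∣ A ∩ rest ∣
      ⋀-split : ∀ {n} (h : Fin m → V n) → ⋀[ h ] K ≋ h min ∧ ⋀[ h ] rest
      e-split : e K ≋ δ min ∧ e rest

  minSplit : ∀ {m} (K : Subset m) → K ≡ ⊥ ⊎ MinSplit K
  minSplit []            = inj₁ ≡.refl
  minSplit (inside ∷ K)  = inj₂ record
    { min  = zero
    ; rest = outside ∷ K
    ; ∣K∣≡1+∣rest∣ = ≡.refl
    ; ∣A∩K∣≡∣A∩min∣+∣A∩rest∣ = λ { (inside ∷ A) → ≡.cong (λ z → suc (z ℕ.+ ∣ A ∩ K ∣)) (≡.sym (∣A∩⊥∣≡0 A))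
                                 ; (outside ∷ A) → ≡.cong (ℕ._+ ∣ A ∩ K ∣) (≡.sym (∣A∩⊥∣≡0 A)) }
    ; ⋀-split = λ h L → refl
    ; e-split = λ { (inside ∷ L)  → sym (trans (+-cong (*-identityˡ _) (-‿cong (tail-δ₀∧≈0 L))) (x-0≈x _))
                  ; (outside ∷ L) → sym (tail-δ₀∧≈0 L) }
    }
    where
    tail-δ₀∧≈0 : ∀ {y} L → (tail (δ zero) ∧ y) L ≈ 0#
    tail-δ₀∧≈0 = ∧-zeroˡ _ (λ _ → refl)
  minSplit (outside ∷ K) with minSplit K
  ... | inj₁ K≡⊥ = inj₁ (≡.cong (outside ∷_) K≡⊥)
  ... | inj₂ split = inj₂ record
    { min  = suc min
    ; rest = outside ∷ rest
    ; ∣K∣≡1+∣rest∣ = ∣K∣≡1+∣rest∣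
    ; ∣A∩K∣≡∣A∩min∣+∣A∩rest∣ = λ { (inside ∷ A) → ∣A∩K∣≡∣A∩min∣+∣A∩rest∣ A
                                 ; (outside ∷ A) → ∣A∩K∣≡∣A∩min∣+∣A∩rest∣ A }
    ; ⋀-split = λ h → ⋀-split (h ∘ suc)
    ; e-split = λ { (inside ∷ L)  → sym (trans (+-cong (zeroˡ _) (-‿cong (∧-zeroʳ (δ min) (λ _ → refl) L))) (x-0≈x _))
                  ; (outside ∷ L) → e-split L }
    }
    where open MinSplit split

  ⋀-insert : ∀ {m n} (h : Fin m → V n) i K →
             h i ∧ ⋀[ h ] K ≋ 𝟎 ⊎ (i ∉ K × ∃ λ ε → h i ∧ ⋀[ h ] K ≋ ε · ⋀[ h ] (K [ i ]≔ inside))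
  ⋀-insert h zero    (inside ∷ K)  = inj₁ (∧-alternating (h zero) _)
  ⋀-insert h zero    (outside ∷ K) = inj₂ ((λ ()) , 1# , λ L → sym (*-identityˡ _))
  ⋀-insert h (suc i) (outside ∷ K) with ⋀-insert (h ∘ suc) i K
  ... | inj₁ vanishes          = inj₁ vanishes
  ... | inj₂ (i∉K , ε , ∧≋ε·) = inj₂ (∉-there i∉K , ε , ∧≋ε·)
  ⋀-insert h (suc i) (inside ∷ K)  with ⋀-insert (h ∘ suc) i K
  ... | inj₁ vanishes          = inj₁ λ L → begin
    (h (suc i) ∧ h zero ∧ ⋀[ h ∘ suc ] K) L      ≈⟨ ∧-anticomm _ _ _ L ⟩
    - (h zero ∧ h (suc i) ∧ ⋀[ h ∘ suc ] K) L    ≈⟨ -‿cong (∧-zeroʳ (h zero) vanishes L) ⟩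
    - 0#                                         ≈⟨ -0#≈0# ⟩
    0#                                           ∎
  ... | inj₂ (i∉K , ε , ∧≋ε·) = inj₂ (∉-there i∉K , - ε , λ L → begin
    (h (suc i) ∧ h zero ∧ ⋀[ h ∘ suc ] K) L                  ≈⟨ ∧-anticomm _ _ _ L ⟩
    - (h zero ∧ h (suc i) ∧ ⋀[ h ∘ suc ] K) L                ≈⟨ -‿cong (∧-cong (λ _ → refl) ∧≋ε· L) ⟩
    - (h zero ∧ (ε · ⋀[ h ∘ suc ] (K [ i ]≔ inside))) L      ≈⟨ -‿cong (∧-scaleʳ ε (h zero) _ L) ⟩
    - (ε * (h zero ∧ ⋀[ h ∘ suc ] (K [ i ]≔ inside)) L)      ≈⟨ -‿distribˡ-* ε _ ⟩
    - ε * (h zero ∧ ⋀[ h ∘ suc ] (K [ i ]≔ inside)) L        ∎)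

  BelowDegree : ∀ {n} → Subset n → ℕ → Λ n → Set ℓ
  BelowDegree A g y = ∀ L → g ≤ ∣ A ∩ L ∣ → y L ≈ 0#

  ⊕-below : ∀ {n} (A : Subset n) {g y z} → BelowDegree A g y → BelowDegree A g z → BelowDegree A g (y ⊕ z)
  ⊕-below A y-below z-below L g≤ = trans (+-cong (y-below L g≤) (z-below L g≤)) (+-identityʳ 0#)

  e-below : ∀ {n} (A K : Subset n) → BelowDegree A (suc ∣ A ∩ K ∣) (e K)
  e-below A K L 1+∣A∩K∣≤∣A∩L∣ = e-offdiag {K = K} {L} λ { ≡.refl → ℕ.<-irrefl ≡.refl 1+∣A∩K∣≤∣A∩L∣ }

  private
    ab-c≈0 : ∀ {a b c} → a ≈ 0# ⊎ b ≈ 0# → c ≈ 0# → a * b - c ≈ 0#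
    ab-c≈0 {a} {b} a≈0⊎b≈0 c≈0 = trans (+-cong (ab≈0 a≈0⊎b≈0) (-‿cong c≈0)) (x-0≈x 0#)
      where
      ab≈0 : a ≈ 0# ⊎ b ≈ 0# → a * b ≈ 0#
      ab≈0 (inj₁ a≈0) = trans (*-congʳ a≈0) (zeroˡ b)
      ab≈0 (inj₂ b≈0) = trans (*-congˡ b≈0) (zeroʳ a)

    ≤-suc-pred : ∀ {g x} → ℕ.pred g ≤ x → g ≤ suc x
    ≤-suc-pred {zero}  _ = z≤n
    ≤-suc-pred {suc g} p = s≤s p

  ∧-below : ∀ {n} (A : Subset n) {g} {w : V n} {y} →
            (∀ j → j ∈ A → w j ≈ 0#) → BelowDegree A g y → BelowDegree A g (w ∧ y)
  ∧-below []          w≈0 y-below []            _  = refl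
  ∧-below (inside ∷ A)  w≈0 y-below (inside ∷ L)  g≤ =
    ab-c≈0 (inj₁ (w≈0 zero here))
           (∧-below A (λ j → w≈0 (suc j) ∘ there) (λ K → y-below (inside ∷ K) ∘ ≤-suc-pred) L (ℕ.pred-mono-≤ g≤))
  ∧-below (inside ∷ A)  w≈0 y-below (outside ∷ L) g≤ =
    ∧-below A (λ j → w≈0 (suc j) ∘ there) (λ K → y-below (outside ∷ K)) L g≤
  ∧-below (outside ∷ A) w≈0 y-below (inside ∷ L)  g≤ =
    ab-c≈0 (inj₂ (y-below (outside ∷ L) g≤))
           (∧-below A (λ j → w≈0 (suc j) ∘ there) (λ K → y-below (inside ∷ K)) L g≤)
  ∧-below (outside ∷ A) w≈0 y-below (outside ∷ L) g≤ =
    ∧-below A (λ j → w≈0 (suc j) ∘ there) (λ K → y-below (outside ∷ K)) L g≤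

  ∧-below-suc : ∀ {n} (A : Subset n) {g} (w : V n) {y} → BelowDegree A g y → BelowDegree A (suc g) (w ∧ y)
  ∧-below-suc []          w y-below []            ()
  ∧-below-suc (inside ∷ A)  {zero}  w y-below (inside ∷ L) (s≤s g≤) =
    ab-c≈0 (inj₂ (y-below (outside ∷ L) g≤)) (∧-zeroʳ (tail w) (λ K → y-below (inside ∷ K) z≤n) L)
  ∧-below-suc (inside ∷ A)  {suc g} w y-below (inside ∷ L) (s≤s g≤) =
    ab-c≈0 (inj₂ (y-below (outside ∷ L) g≤)) (∧-below-suc A (tail w) (λ K → y-below (inside ∷ K) ∘ s≤s) L g≤)
  ∧-below-suc (inside ∷ A)  w y-below (outside ∷ L) g≤ =
    ∧-below-suc A (tail w) (λ K → y-below (outside ∷ K)) L g≤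
  ∧-below-suc (outside ∷ A) w y-below (inside ∷ L)  g≤ =
    ab-c≈0 (inj₂ (y-below (outside ∷ L) (ℕ.<⇒≤ g≤))) (∧-below-suc A (tail w) (λ K → y-below (inside ∷ K)) L g≤)
  ∧-below-suc (outside ∷ A) w y-below (outside ∷ L) g≤ =
    ∧-below-suc A (tail w) (λ K → y-below (outside ∷ K)) L g≤

  below-≋ : ∀ {n} (A : Subset n) {g} {y y′ : Λ n} → y ≋ y′ → BelowDegree A g y′ → BelowDegree A g y
  below-≋ A y≋y′ y′-below L g≤ = trans (y≋y′ L) (y′-below L g≤)

  private
    telescope : ∀ a b c → a - b ≈ (a - c) + (c - b)
    telescope a b c = begin
      a - b                  ≈⟨ +-congʳ (+-identityʳ a) ⟨
      a + 0# - b             ≈⟨ +-congʳ (+-congˡ (-‿inverseˡ c)) ⟨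
      a + (- c + c) - b      ≈⟨ +-congʳ (+-assoc a (- c) c) ⟨
      a - c + c - b          ≈⟨ +-assoc (a - c) c (- b) ⟩
      (a - c) + (c - b)      ∎

  module Adapted {n} (A : Subset n) (u : Fin n → V n)
                 (u≈δ-on-A : ∀ i j → j ∈ A → u i j ≈ δ i j)
                 (u≋δ-off-A : ∀ i → i ∉ A → u i ≋ δ i) where

    W : Subset n → Λ n
    W K = ⋀[ u ] K

    u⊖δ-vanishes-on-A : ∀ i j → j ∈ A → (u i ⊖ δ i) j ≈ 0#
    u⊖δ-vanishes-on-A i j j∈A = trans (+-congʳ (u≈δ-on-A i j j∈A)) (-‿inverseʳ _)

    u-vanishes-on-A : ∀ {i} → i ∉ A → ∀ j → j ∈ A → u i j ≈ 0#
    u-vanishes-on-A {i} i∉A j j∈A = trans (u≈δ-on-A i j j∈A) (δ-offdiag {i = i} {j} λ { ≡.refl → i∉A j∈A })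

    module _ {K : Subset n} (split : MinSplit K) where
      open MinSplit split

      W⊖e-split : W K ⊖ e K ≋ u min ∧ (W rest ⊖ e rest) ⊕ (u min ⊖ δ min) ∧ e rest
      W⊖e-split L = begin
        W K L - e K L                                   ≈⟨ +-cong (⋀-split u L) (-‿cong (e-split L)) ⟩
        (u min ∧ W rest) L - (δ min ∧ e rest) L         ≈⟨ telescope _ _ ((u min ∧ e rest) L) ⟩
        ((u min ∧ W rest) L - (u min ∧ e rest) L) + ((u min ∧ e rest) L - (δ min ∧ e rest) L)
          ≈⟨ +-cong (∧-distribˡ-⊖ (u min) _ _ L) (∧-distribʳ-⊖ (u min) _ _ L) ⟨
        (u min ∧ (W rest ⊖ e rest)) L + ((u min ⊖ δ min) ∧ e rest) L  ∎

      private
        below-shift : ∀ {g y} → ∣ A ∩ ⁅ min ⁆ ∣ ≡ g → BelowDegree A (g ℕ.+ ∣ A ∩ rest ∣) y → BelowDegree A ∣ A ∩ K ∣ y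
        below-shift ≡.refl = ≡.subst (λ g → BelowDegree A g _) (≡.sym (∣A∩K∣≡∣A∩min∣+∣A∩rest∣ A))

      W⊖e-below-step : BelowDegree A ∣ A ∩ rest ∣ (W rest ⊖ e rest) → BelowDegree A ∣ A ∩ K ∣ (W K ⊖ e K)
      W⊖e-below-step rest-below with min ∈? A
      ... | yes min∈A = below-shift (∣A∩⁅i⁆∣≡1 min∈A) (below-≋ A W⊖e-split
              (⊕-below A (∧-below-suc A (u min) rest-below) (∧-below A (u⊖δ-vanishes-on-A min) (e-below A rest))))
      ... | no  min∉A = below-shift (∣A∩⁅i⁆∣≡0 min∉A) (below-≋ A W⊖e-split
              (⊕-below A (∧-below A (u-vanishes-on-A min∉A) rest-below) (λ L _ → ∧-zeroˡ (e rest) u⊖δ≋0 L)))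
        where
        u⊖δ≋0 : u min ⊖ δ min ≋ 𝟎
        u⊖δ≋0 j = trans (+-congʳ (u≋δ-off-A min min∉A j)) (-‿inverseʳ _)

    W⊖e-below : ∀ K → BelowDegree A ∣ A ∩ K ∣ (W K ⊖ e K)
    W⊖e-below K = go ∣ K ∣ K ≡.refl
      where
      go : ∀ s K → ∣ K ∣ ≡ s → BelowDegree A ∣ A ∩ K ∣ (W K ⊖ e K)
      go s K ∣K∣≡s with minSplit K
      ... | inj₁ ≡.refl = λ L _ → trans (+-congʳ (reflexive (≡.cong (λ y → y L) (⋀[]⊥≡e⊥ u)))) (-‿inverseʳ _)
      go zero    K ∣K∣≡0 | inj₂ split = contradiction (≡.trans (≡.sym (MinSplit.∣K∣≡1+∣rest∣ split)) ∣K∣≡0) λ ()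
      go (suc s) K ∣K∣≡s | inj₂ split = W⊖e-below-step split
        (go s (MinSplit.rest split) (ℕ.suc-injective (≡.trans (≡.sym (MinSplit.∣K∣≡1+∣rest∣ split)) ∣K∣≡s)))

    ⋀-unitriangular : ∀ K L → ∣ A ∩ K ∣ ≤ ∣ A ∩ L ∣ → W K L ≈ e K L
    ⋀-unitriangular K L ∣A∩K∣≤∣A∩L∣ = x∙y⁻¹≈ε⇒x≈y _ _ (W⊖e-below K L ∣A∩K∣≤∣A∩L∣)

    lincomb : V n → V n
    lincomb c j = sum λ i → c i * u i j

    lincomb-⊕ : ∀ c d → lincomb (c ⊕ d) ≋ lincomb c ⊕ lincomb d
    lincomb-⊕ c d j =
      trans (sum-cong-≋ λ i → distribʳ (u i j) (c i) (d i)) (∑-distrib-+ (λ i → c i * u i j) (λ i → d i * u i j))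

    lincomb-on-A : ∀ c j → j ∈ A → lincomb c j ≈ c j
    lincomb-on-A c j j∈A = trans (sum-cong-≋ λ i → *-congˡ (u≈δ-on-A i j j∈A)) (sum-δ c j)

    lincomb-vanishing-on-A : ∀ c → (∀ i → i ∈ A → c i ≈ 0#) → lincomb c ≋ c
    lincomb-vanishing-on-A c c≈0 j = trans (sum-cong-≋ term) (sum-δ c j)
      where
      term : ∀ i → c i * u i j ≈ c i * δ i j
      term i with i ∈? A
      ... | yes i∈A = trans (*-congʳ (c≈0 i i∈A)) (trans (zeroˡ _) (sym (trans (*-congʳ (c≈0 i i∈A)) (zeroˡ _))))
      ... | no  i∉A = *-congˡ (u≋δ-off-A i i∉A j)

    restrict : V n → V n
    restrict w i = if does (i ∈? A) then w i else 0#

    restrict-on-A : ∀ w i → i ∈ A → restrict w i ≈ w i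
    restrict-on-A w i i∈A with i ∈? A
    ... | yes _   = refl
    ... | no  i∉A = contradiction i∈A i∉A

    restrict-off-A : ∀ w i → i ∉ A → restrict w i ≈ 0#
    restrict-off-A w i i∉A with i ∈? A
    ... | yes i∈A = contradiction i∈A i∉A
    ... | no  _   = refl

    lincomb-surjective : ∀ w → ∃ λ c → w ≋ lincomb c
    lincomb-surjective w = restrict w ⊕ r , λ j → begin
      w j                                   ≈⟨ y+[x-y]≈x (w j) _ ⟨
      lincomb (restrict w) j + r j          ≈⟨ +-congˡ (lincomb-vanishing-on-A r r-on-A j) ⟨
      lincomb (restrict w) j + lincomb r j  ≈⟨ lincomb-⊕ (restrict w) r j ⟨
      lincomb (restrict w ⊕ r) j            ∎
      where
      r : V n
      r = w ⊖ lincomb (restrict w)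
      r-on-A : ∀ i → i ∈ A → r i ≈ 0#
      r-on-A i i∈A = x≈y⇒x∙y⁻¹≈ε (sym (trans (lincomb-on-A (restrict w) i i∈A) (restrict-on-A w i i∈A)))

    Eligible : ℕ → ℕ → Subset n → Set
    Eligible v t K = ∣ K ∣ ≡ v × t ≤ ∣ A ∩ K ∣

    eligible? : ∀ v t K → Dec (Eligible v t K)
    eligible? v t K = ∣ K ∣ ℕ.≟ v ×-dec t ℕ.≤? ∣ A ∩ K ∣

    Supported : ℕ → ℕ → Λ n → Set ℓ
    Supported v t a = ∀ K → ¬ Eligible v t K → a K ≈ 0#

    W⟨_⟩ : Λ n → Λ n
    W⟨ a ⟩ L = ∑ₛ λ K → a K * W K L

    InSpan : ℕ → ℕ → Λ n → Set (c ⊔ ℓ)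
    InSpan v t x = ∃ λ a → Supported v t a × x ≋ W⟨ a ⟩

    W⟨⟩-⊕ : ∀ a b → W⟨ a ⊕ b ⟩ ≋ W⟨ a ⟩ ⊕ W⟨ b ⟩
    W⟨⟩-⊕ a b L =
      trans (∑ₛ-cong λ K → distribʳ (W K L) (a K) (b K)) (∑ₛ-distrib-+ (λ K → a K * W K L) (λ K → b K * W K L))

    W⟨⟩-· : ∀ s a → W⟨ s · a ⟩ ≋ s · W⟨ a ⟩
    W⟨⟩-· s a L = trans (∑ₛ-cong λ K → *-assoc s (a K) (W K L)) (*-distribˡ-∑ₛ s (λ K → a K * W K L))

    W⟨⟩-⊖ : ∀ a b → W⟨ a ⊖ b ⟩ ≋ W⟨ a ⟩ ⊖ W⟨ b ⟩
    W⟨⟩-⊖ a b L = begin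
      W⟨ a ⊖ b ⟩ L                   ≈⟨ ∑ₛ-cong (λ K → *-congʳ (⊖≋⊕-1· a b K)) ⟩
      W⟨ a ⊕ (- 1#) · b ⟩ L          ≈⟨ W⟨⟩-⊕ a _ L ⟩
      W⟨ a ⟩ L + W⟨ (- 1#) · b ⟩ L   ≈⟨ +-congˡ (W⟨⟩-· (- 1#) b L) ⟩
      W⟨ a ⟩ L + - 1# * W⟨ b ⟩ L     ≈⟨ ⊖≋⊕-1· W⟨ a ⟩ W⟨ b ⟩ L ⟨
      W⟨ a ⟩ L - W⟨ b ⟩ L            ∎

    W⟨⟩-coordinate : ∀ a L → (∀ K → ∣ A ∩ L ∣ < ∣ A ∩ K ∣ → a K ≈ 0#) → W⟨ a ⟩ L ≈ a L
    W⟨⟩-coordinate a L a≈0-above = begin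
      W⟨ a ⟩ L      ≈⟨ ∑ₛ-single (λ K → a K * W K L) L other-terms ⟩
      a L * W L L   ≈⟨ *-congˡ (trans (⋀-unitriangular L L ℕ.≤-refl) (e-diag L)) ⟩
      a L * 1#      ≈⟨ *-identityʳ (a L) ⟩
      a L           ∎
      where
      other-terms : ∀ K → K ≢ L → a K * W K L ≈ 0#
      other-terms K K≢L with ∣ A ∩ L ∣ ℕ.<? ∣ A ∩ K ∣
      ... | yes below = trans (*-congʳ (a≈0-above K below)) (zeroˡ _)
      ... | no  ¬below = trans (*-congˡ (trans (⋀-unitriangular K L (ℕ.≮⇒≥ ¬below)) (e-offdiag K≢L))) (zeroʳ _)

    InSpan-≋ : ∀ {v t x x′} → x ≋ x′ → InSpan v t x′ → InSpan v t x
    InSpan-≋ x≋x′ (a , a-supp , x′≋W⟨a⟩) = a , a-supp , λ L → trans (x≋x′ L) (x′≋W⟨a⟩ L)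

    InSpan-𝟎 : ∀ {v t} → InSpan v t 𝟎
    InSpan-𝟎 = 𝟎 , (λ _ _ → refl) , λ L → sym (∑ₛ-zero λ K → zeroˡ (W K L))

    InSpan-⊕ : ∀ {v t x y} → InSpan v t x → InSpan v t y → InSpan v t (x ⊕ y)
    InSpan-⊕ (a , a-supp , x≋) (b , b-supp , y≋) =
      a ⊕ b , (λ K ¬el → trans (+-cong (a-supp K ¬el) (b-supp K ¬el)) (+-identityʳ 0#)) ,
      λ L → trans (+-cong (x≋ L) (y≋ L)) (sym (W⟨⟩-⊕ a b L))

    InSpan-· : ∀ {v t} s {x} → InSpan v t x → InSpan v t (s · x)
    InSpan-· s (a , a-supp , x≋) =
      s · a , (λ K ¬el → trans (*-congˡ (a-supp K ¬el)) (zeroʳ s)) , λ L → trans (*-congˡ (x≋ L)) (sym (W⟨⟩-· s a L))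

    InSpan-sum : ∀ {v t m} (f : Fin m → Λ n) → (∀ i → InSpan v t (f i)) → InSpan v t (λ L → sum λ i → f i L)
    InSpan-sum {m = zero}  f f-span = InSpan-𝟎
    InSpan-sum {m = suc m} f f-span = InSpan-⊕ (f-span zero) (InSpan-sum (f ∘ suc) (f-span ∘ suc))

    InSpan-∑ₛ : ∀ {v t m} (F : Subset m → Λ n) → (∀ K → InSpan v t (F K)) → InSpan v t (λ L → ∑ₛ λ K → F K L)
    InSpan-∑ₛ {m = zero}  F F-span = F-span []
    InSpan-∑ₛ {m = suc m} F F-span =
      InSpan-⊕ (InSpan-∑ₛ (F ∘ (inside ∷_)) (F-span ∘ (inside ∷_)))
               (InSpan-∑ₛ (F ∘ (outside ∷_)) (F-span ∘ (outside ∷_)))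

    InSpan-mono : ∀ {v t t′ x} → t′ ≤ t → InSpan v t x → InSpan v t′ x
    InSpan-mono t′≤t (a , a-supp , x≋) =
      a , (λ K ¬el → a-supp K λ { (∣K∣≡v , t≤) → ¬el (∣K∣≡v , ℕ.≤-trans t′≤t t≤) }) , x≋

    InSpan-W : ∀ {v t} K → Eligible v t K → InSpan v t (W K)
    InSpan-W K K-eligible = e K , e-supp , λ L → sym (W⟨e⟩ L)
      where
      e-supp : ∀ K′ → ¬ Eligible _ _ K′ → e K K′ ≈ 0#
      e-supp K′ ¬el = e-offdiag {K = K} {K′} λ { ≡.refl → ¬el K-eligible }
      W⟨e⟩ : W⟨ e K ⟩ ≋ W K
      W⟨e⟩ L = begin
        W⟨ e K ⟩ L     ≈⟨ ∑ₛ-single (λ K′ → e K K′ * W K′ L) K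
                             (λ K′ K′≢K → trans (*-congʳ (e-offdiag (K′≢K ∘ ≡.sym))) (zeroˡ _)) ⟩
        e K K * W K L  ≈⟨ *-congʳ (e-diag K) ⟩
        1# * W K L     ≈⟨ *-identityˡ _ ⟩
        W K L          ∎

    InSpan-e⊥ : InSpan 0 0 (e ⊥)
    InSpan-e⊥ = ≡.subst (InSpan 0 0) (⋀[]⊥≡e⊥ u) (InSpan-W ⊥ (∣⊥∣≡0 n , z≤n))

    u∧W-span : ∀ {v t} i K → Eligible v t K → InSpan (suc v) (∣ A ∩ ⁅ i ⁆ ∣ ℕ.+ t) (u i ∧ W K)
    u∧W-span {v} {t} i K (∣K∣≡v , t≤∣A∩K∣) with ⋀-insert u i K
    ... | inj₁ vanishes           = InSpan-≋ vanishes InSpan-𝟎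
    ... | inj₂ (i∉K , ε , ∧≋ε·W) = InSpan-≋ ∧≋ε·W (InSpan-· ε (InSpan-W (K [ i ]≔ inside) (∣K+i∣≡1+v , deg≤)))
      where
      ∣K+i∣≡1+v : ∣ K [ i ]≔ inside ∣ ≡ suc v
      ∣K+i∣≡1+v = ≡.trans (∣insert∣ i∉K) (≡.cong suc ∣K∣≡v)
      deg≤ : ∣ A ∩ ⁅ i ⁆ ∣ ℕ.+ t ≤ ∣ A ∩ (K [ i ]≔ inside) ∣
      deg≤ = ≡.subst (_ ≤_) (≡.sym (∣A∩insert∣ A i∉K)) (ℕ.+-monoʳ-≤ ∣ A ∩ ⁅ i ⁆ ∣ t≤∣A∩K∣)

    u∧-span : ∀ {v t} i {y} → InSpan v t y → InSpan (suc v) (∣ A ∩ ⁅ i ⁆ ∣ ℕ.+ t) (u i ∧ y)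
    u∧-span {v} {t} i {y} (a , a-supp , y≋W⟨a⟩) = InSpan-≋ expand (InSpan-∑ₛ _ term)
      where
      expand : u i ∧ y ≋ λ L → ∑ₛ λ K → (a K · (u i ∧ W K)) L
      expand L = begin
        (u i ∧ y) L                         ≈⟨ ∧-cong (λ _ → refl) y≋W⟨a⟩ L ⟩
        (u i ∧ W⟨ a ⟩) L                    ≈⟨ ∧-∑ₛ (u i) (λ K → a K · W K) L ⟩
        (∑ₛ λ K → (u i ∧ (a K · W K)) L)    ≈⟨ ∑ₛ-cong (λ K → ∧-scaleʳ (a K) (u i) (W K) L) ⟩
        (∑ₛ λ K → (a K · (u i ∧ W K)) L)    ∎
      term : ∀ K → InSpan (suc v) (∣ A ∩ ⁅ i ⁆ ∣ ℕ.+ t) (a K · (u i ∧ W K))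
      term K with eligible? v t K
      ... | yes K-eligible = InSpan-· (a K) (u∧W-span i K K-eligible)
      ... | no  ¬eligible  = InSpan-≋ (λ L → trans (*-congʳ (a-supp K ¬eligible)) (zeroˡ _)) InSpan-𝟎

    lincomb-∧ : ∀ c y → lincomb c ∧ y ≋ λ L → sum λ i → (c i · (u i ∧ y)) L
    lincomb-∧ c y L = trans (∧-sumˡ (λ i → c i · u i) y L) (sum-cong-≋ λ i → ∧-scaleˡ (c i) (u i) y L)

    lincomb∧-span : ∀ {v t} c {y} → InSpan v t y → InSpan (suc v) t (lincomb c ∧ y)
    lincomb∧-span c y-span = InSpan-≋ (lincomb-∧ c _)
      (InSpan-sum _ λ i → InSpan-· (c i) (InSpan-mono (ℕ.m≤n+m _ _) (u∧-span i y-span)))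

    lincomb∧-span-A : ∀ {v t} c {y} → (∀ i → i ∉ A → c i ≈ 0#) → InSpan v t y → InSpan (suc v) (suc t) (lincomb c ∧ y)
    lincomb∧-span-A {v} {t} c {y} c-off-A y-span = InSpan-≋ (lincomb-∧ c y) (InSpan-sum _ term)
      where
      term : ∀ i → InSpan (suc v) (suc t) (c i · (u i ∧ y))
      term i with i ∈? A
      ... | yes i∈A =
        InSpan-· (c i) (≡.subst (λ d → InSpan (suc v) (d ℕ.+ t) (u i ∧ y)) (∣A∩⁅i⁆∣≡1 i∈A) (u∧-span i y-span))
      ... | no  i∉A = InSpan-≋ (λ L → trans (*-congʳ (c-off-A i i∉A)) (zeroˡ _)) InSpan-𝟎

    private
      nothing-above-n : ∀ {p} (P : Subset n → Set p) K → suc n ≤ ∣ A ∩ K ∣ → P K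
      nothing-above-n P K n<∣A∩K∣ = contradiction (∣p∣≤n (A ∩ K)) (ℕ.<⇒≱ n<∣A∩K∣)

    downward-induction : ∀ {p} (P : Subset n → Set p) →
                         (∀ K → (∀ K′ → ∣ A ∩ K ∣ < ∣ A ∩ K′ ∣ → P K′) → P K) → ∀ K → P K
    downward-induction P step K = count-down (λ s → ∀ K → s ≤ ∣ A ∩ K ∣ → P K) (nothing-above-n P)
      (λ s P-above K s≤ → step K λ K′ deg< → P-above K′ (ℕ.≤-<-trans s≤ deg<)) K z≤n

    W⟨⟩-injective : ∀ {v t} a b → Supported v t a → Supported v t b →
                    (∀ L → Eligible v t L → W⟨ a ⟩ L ≈ W⟨ b ⟩ L) → a ≋ b
    W⟨⟩-injective {v} {t} a b a-supp b-supp W⟨a⟩≈W⟨b⟩ K =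
      x∙y⁻¹≈ε⇒x≈y _ _ (downward-induction (λ K → (a ⊖ b) K ≈ 0#) step K)
      where
      step : ∀ K → (∀ K′ → ∣ A ∩ K ∣ < ∣ A ∩ K′ ∣ → (a ⊖ b) K′ ≈ 0#) → (a ⊖ b) K ≈ 0#
      step K a⊖b≈0-above with eligible? v t K
      ... | yes K-eligible = begin
        (a ⊖ b) K            ≈⟨ W⟨⟩-coordinate (a ⊖ b) K a⊖b≈0-above ⟨
        W⟨ a ⊖ b ⟩ K         ≈⟨ W⟨⟩-⊖ a b K ⟩
        W⟨ a ⟩ K - W⟨ b ⟩ K  ≈⟨ x≈y⇒x∙y⁻¹≈ε (W⟨a⟩≈W⟨b⟩ K K-eligible) ⟩
        0#                   ∎
      ... | no  ¬eligible  = trans (+-cong (a-supp K ¬eligible) (-‿cong (b-supp K ¬eligible))) (x-0≈x 0#)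

    module _ (v t : ℕ) (f : Λ n) where

      MatchesFrom : ℕ → Λ n → Set ℓ
      MatchesFrom s a = ∀ L → Eligible v t L → s ≤ ∣ A ∩ L ∣ → W⟨ a ⟩ L ≈ f L

      -- Correcting the coefficients of A-degree s leaves the coordinates of higher A-degree unchanged,
      -- by unitriangularity.
      match-level : ∀ s a → Supported v t a → MatchesFrom (suc s) a → ∃ λ a′ → Supported v t a′ × MatchesFrom s a′
      match-level s a a-supp a-matches = a ⊕ d , d-supp , matches
        where
        on-level? : ∀ K → Dec (Eligible v t K × ∣ A ∩ K ∣ ≡ s)
        on-level? K = eligible? v t K ×-dec ∣ A ∩ K ∣ ℕ.≟ s

        d : Λ n
        d K = correction (on-level? K)
          where
          correction : Dec (Eligible v t K × ∣ A ∩ K ∣ ≡ s) → Carrier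
          correction (yes _) = f K - W⟨ a ⟩ K
          correction (no  _) = 0#

        d-off-level : ∀ K → ¬ (Eligible v t K × ∣ A ∩ K ∣ ≡ s) → d K ≈ 0#
        d-off-level K off with on-level? K
        ... | yes on = contradiction on off
        ... | no  _  = refl

        d-on-level : ∀ K → Eligible v t K × ∣ A ∩ K ∣ ≡ s → d K ≈ f K - W⟨ a ⟩ K
        d-on-level K on with on-level? K
        ... | yes _ = refl
        ... | no off = contradiction on off

        d-supp : Supported v t (a ⊕ d)
        d-supp K ¬eligible = trans (+-cong (a-supp K ¬eligible) (d-off-level K (¬eligible ∘ proj₁))) (+-identityʳ 0#)

        W⟨d⟩≈d : ∀ L → s ≤ ∣ A ∩ L ∣ → W⟨ d ⟩ L ≈ d L
        W⟨d⟩≈d L s≤ = W⟨⟩-coordinate d L λ K deg< →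
          d-off-level K λ { (_ , ∣A∩K∣≡s) → ℕ.<-irrefl (≡.sym ∣A∩K∣≡s) (ℕ.≤-<-trans s≤ deg<) }

        matches : MatchesFrom s (a ⊕ d)
        matches L L-eligible s≤ = trans (W⟨⟩-⊕ a d L) (trans (+-congˡ (W⟨d⟩≈d L s≤)) by-level)
          where
          by-level : W⟨ a ⟩ L + d L ≈ f L
          by-level with s ℕ.<? ∣ A ∩ L ∣
          ... | yes s< = trans (+-cong (a-matches L L-eligible s<)
                                       (d-off-level L λ { (_ , ∣A∩L∣≡s) → ℕ.<-irrefl (≡.sym ∣A∩L∣≡s) s< }))
                               (+-identityʳ _)
          ... | no  ¬s< = trans (+-congˡ (d-on-level L (L-eligible , ℕ.≤-antisym (ℕ.≮⇒≥ ¬s<) s≤))) (y+[x-y]≈x _ _)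

      W⟨⟩-interpolates : ∃ λ a → Supported v t a × ∀ L → Eligible v t L → W⟨ a ⟩ L ≈ f L
      W⟨⟩-interpolates with count-down (λ s → ∃ λ a → Supported v t a × MatchesFrom s a)
                                       (𝟎 , (λ _ _ → refl) , λ L _ → nothing-above-n (λ L → W⟨ 𝟎 ⟩ L ≈ f L) L)
                                       (λ s (a , a-supp , a-matches) → match-level s a a-supp a-matches)
      ... | a , a-supp , a-matches = a , a-supp , λ L L-eligible → a-matches L L-eligible z≤n

module Plücker {c ℓ} (F : Field c ℓ) where
  open Field F hiding (zero)
  open LinAlg F using (sumFin; sign; det; Matrix; π)
  open ExteriorAlgebra commutativeRing
  open import Algebra.Properties.Ring ring using (-‿distribˡ-*)
  open import Algebra.Properties.Semiring.Sum semiring using (sum; sum-cong-≋)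
  open import Relation.Binary.Reasoning.Setoid setoid

  sumFin≡sum : ∀ {m} (f : V m) → sumFin f ≡ sum f
  sumFin≡sum {zero}  f = ≡.refl
  sumFin≡sum {suc m} f = ≡.cong (f zero +_) (sumFin≡sum (f ∘ suc))

  sum-cast : ∀ {a b} (eq : b ≡ a) (f : V a) → sum (f ∘ cast eq) ≈ sum f
  sum-cast ≡.refl f = sum-cong-≋ λ j → reflexive (≡.cong f (Fin.cast-is-id ≡.refl j))

  sign-cast : ∀ {a b} (eq : a ≡ b) j → sign (cast eq j) ≡ sign j
  sign-cast ≡.refl j = ≡.cong sign (Fin.cast-is-id ≡.refl j)

  lookup-subst : ∀ {a b} {X : Set} (eq : a ≡ b) (xs : Vec X a) j →
                 lookup (≡.subst (Vec X) eq xs) j ≡ lookup xs (cast (≡.sym eq) j)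
  lookup-subst ≡.refl xs j = ≡.cong (lookup xs) (≡.sym (Fin.cast-is-id ≡.refl j))

  det-cong : ∀ {m} {A B : Fin m → Fin m → Carrier} → (∀ i j → A i j ≈ B i j) → det A ≈ det B
  det-cong {zero}  A≈B = refl
  det-cong {suc m} {A} {B} A≈B = begin
    sumFin (expansion A)  ≡⟨ sumFin≡sum (expansion A) ⟩
    sum (expansion A)     ≈⟨ sum-cong-≋ (λ j → *-congˡ {sign j} (*-cong (A≈B zero j) (minor≈ j))) ⟩
    sum (expansion B)     ≡⟨ sumFin≡sum (expansion B) ⟨
    sumFin (expansion B)  ∎
    where
    expansion : (Fin (suc m) → Fin (suc m) → Carrier) → V (suc m)
    expansion C j = sign j * (C zero j * det λ i k → C (suc i) (punchIn j k))
    minor≈ : ∀ j → det (λ i k → A (suc i) (punchIn j k)) ≈ det (λ i k → B (suc i) (punchIn j k))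
    minor≈ j = det-cong λ i k → A≈B (suc i) (punchIn j k)

  ∧-laplace : ∀ {n} (w : V n) y L → (w ∧ y) L ≈ sum λ j → sign j * (w (lookup (elems L) j) * y (delete L j))
  ∧-laplace w y []            = refl
  ∧-laplace {suc n} w y (inside ∷ L)  = begin
    w zero * y (outside ∷ L) - (tail w ∧ yᵢ) L
      ≈⟨ +-cong (*-identityˡ _) (-‿cong (sym (∧-laplace (tail w) yᵢ L))) ⟨
    1# * (w zero * y (outside ∷ L)) - sum minor-term     ≈⟨ +-congˡ (sum-neg minor-term) ⟨
    1# * (w zero * y (outside ∷ L)) + sum (⊝ minor-term)
      ≈⟨ +-congˡ (sum-cong-≋ λ j → trans (-‿distribˡ-* _ _) (*-congˡ (*-congʳ (w-lookup-map j)))) ⟩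
    1# * (w zero * y (outside ∷ L)) + sum (λ j → - sign j * (w (lookup (Vec.map suc (elems L)) j) * yᵢ (delete L j)))
      ∎
    where
    yᵢ : Λ n
    yᵢ = y ∘ (inside ∷_)
    minor-term : V ∣ L ∣
    minor-term j = sign j * (tail w (lookup (elems L) j) * yᵢ (delete L j))
    w-lookup-map : ∀ j → w (suc (lookup (elems L) j)) ≈ w (lookup (Vec.map suc (elems L)) j)
    w-lookup-map j = reflexive (≡.cong w (≡.sym (VecP.lookup-map j suc (elems L))))
  ∧-laplace w y (outside ∷ L) = trans (∧-laplace (tail w) (y ∘ (outside ∷_)) L)
    (sum-cong-≋ λ j → *-congˡ (*-congʳ (reflexive (≡.cong w (≡.sym (VecP.lookup-map j suc (elems L)))))))

  elems-delete : ∀ {n v} (L : Subset n) (eq : ∣ L ∣ ≡ suc v) j → let L′ = delete L (cast (≡.sym eq) j) in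
                 Σ (∣ L′ ∣ ≡ v) λ eq′ →
                   ∀ k → lookup (elems L′) (cast (≡.sym eq′) k) ≡ lookup (elems L) (cast (≡.sym eq) (punchIn j k))
  elems-delete (inside ∷ L)  eq zero    = ℕ.suc-injective eq , λ k → ≡.refl
  elems-delete {v = suc v} (inside ∷ L) eq (suc j) with elems-delete L (ℕ.suc-injective eq) j
  ... | eq′ , lookup≡ = ≡.cong suc eq′ , λ
    { zero    → ≡.refl
    ; (suc k) → ≡.trans (VecP.lookup-map _ suc (elems (delete L _)))
                  (≡.trans (≡.cong suc (lookup≡ k)) (≡.sym (VecP.lookup-map _ suc (elems L)))) }
  elems-delete (outside ∷ L) eq j with elems-delete L eq j
  ... | eq′ , lookup≡ = eq′ , λ k → ≡.trans (VecP.lookup-map _ suc (elems (delete L _)))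
                  (≡.trans (≡.cong suc (lookup≡ k)) (≡.sym (VecP.lookup-map _ suc (elems L))))

  π≈⋀ : ∀ {v n} (M : Matrix v n) L (eq : ∣ L ∣ ≡ v) → π M (L , eq) ≈ ⋀ M L
  π≈⋀ {zero}      M L eq = sym (e⊥-at-empty L eq)
  π≈⋀ {suc v} {n} M L eq = begin
    sumFin expansion                             ≡⟨ sumFin≡sum expansion ⟩
    sum expansion                                ≈⟨ sum-cong-≋ expansion≈laplace ⟩
    sum (laplace-term ∘ cast (≡.sym eq))         ≈⟨ sum-cast (≡.sym eq) laplace-term ⟩
    sum laplace-term                             ≈⟨ ∧-laplace (M zero) (⋀ (M ∘ suc)) L ⟨
    (M zero ∧ ⋀ (M ∘ suc)) L                     ∎
    where
    col : Fin (suc v) → Fin n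
    col = lookup (≡.subst (Vec (Fin n)) eq (elems L))
    expansion : V (suc v)
    expansion j = sign j * (M zero (col j) * det λ i k → M (suc i) (col (punchIn j k)))
    laplace-term : V ∣ L ∣
    laplace-term j = sign j * (M zero (lookup (elems L) j) * ⋀ (M ∘ suc) (delete L j))

    minor≈ : ∀ j → det (λ i k → M (suc i) (col (punchIn j k))) ≈ ⋀ (M ∘ suc) (delete L (cast (≡.sym eq) j))
    minor≈ j with elems-delete L eq j
    ... | eq′ , lookup≡ = trans (det-cong λ i k → reflexive (≡.cong (M (suc i)) (same-column k)))
                                (π≈⋀ (M ∘ suc) (delete L (cast (≡.sym eq) j)) eq′)
      where
      same-column : ∀ k → col (punchIn j k) ≡
                          lookup (≡.subst (Vec (Fin n)) eq′ (elems (delete L (cast (≡.sym eq) j)))) k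
      same-column k = ≡.trans (lookup-subst eq (elems L) _)
                        (≡.trans (≡.sym (lookup≡ k)) (≡.sym (lookup-subst eq′ (elems (delete L _)) k)))

    expansion≈laplace : ∀ j → expansion j ≈ laplace-term (cast (≡.sym eq) j)
    expansion≈laplace j = *-cong (reflexive (≡.sym (sign-cast (≡.sym eq) j)))
      (*-cong (reflexive (≡.cong (M zero) (lookup-subst eq (elems L) j))) (minor≈ j))

open import Data.Integer using (+_; _-_)

i-j≤i-k⇔k≤j : ∀ i j k → (+ i - + j ℤ.≤ + i - + k) ⇔ k ≤ j
i-j≤i-k⇔k≤j i j k = mk⇔
  (λ i-j≤i-k → ℤ.drop‿+≤+ (ℤ.neg-cancel-≤ (≡.subst₂ ℤ._≤_ (cancel j) (cancel k) (ℤ.+-monoʳ-≤ (ℤ.- + i) i-j≤i-k))))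
  (λ k≤j → ℤ.+-monoʳ-≤ (+ i) (ℤ.neg-mono-≤ (ℤ.+≤+ k≤j)))
  where
  cancel : ∀ j → ℤ.- + i ℤ.+ (+ i - + j) ≡ ℤ.- + j
  cancel j = ≡.trans (≡.sym (ℤ.+-assoc (ℤ.- + i) (+ i) (ℤ.- + j)))
               (≡.trans (≡.cong (ℤ._+ ℤ.- + j) (ℤ.+-inverseˡ (+ i))) (ℤ.+-identityˡ _))

InBall⇔ : ∀ {n v k} t (A L : Subset n) → ∣ L ∣ ≡ v → ∣ A ∣ ≡ k →
          InBall (+ (v ⊓ k) - + t) A L ⇔ t ≤ ∣ A ∩ L ∣
InBall⇔ {v = v} {k} t A L ∣L∣≡v ∣A∣≡k =
  ≡.subst (λ B → (B ℤ.≤ + (v ⊓ k) - + t) ⇔ _) (≡.sym distance≡) (i-j≤i-k⇔k≤j (v ⊓ k) ∣ A ∩ L ∣ t)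
  where
  g : ℕ
  g = ∣ A ∩ L ∣
  ∣L─A∣≡v∸g : ∣ L ─ A ∣ ≡ v ℕ.∸ g
  ∣L─A∣≡v∸g = ≡.trans (≡.sym (ℕ.m+n∸n≡m _ g)) (≡.cong (ℕ._∸ g) (≡.trans (∣L─A∣+∣A∩L∣≡∣L∣ A L) ∣L∣≡v))
  ∣A─L∣≡k∸g : ∣ A ─ L ∣ ≡ k ℕ.∸ g
  ∣A─L∣≡k∸g = ≡.trans (≡.sym (ℕ.m+n∸n≡m _ g)) (≡.cong (ℕ._∸ g) (≡.trans (∣A─L∣+∣A∩L∣≡∣A∣ A L) ∣A∣≡k))
  g≤v⊓k : g ≤ v ⊓ k
  g≤v⊓k = ℕ.⊓-glb (≡.subst (g ≤_) (≡.trans (∣L─A∣+∣A∩L∣≡∣L∣ A L) ∣L∣≡v) (ℕ.m≤n+m g _))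
                  (≡.subst (g ≤_) (≡.trans (∣A─L∣+∣A∩L∣≡∣A∣ A L) ∣A∣≡k) (ℕ.m≤n+m g _))
  distance≡ : + (∣ L ─ A ∣ ⊓ ∣ A ─ L ∣) ≡ + (v ⊓ k) - + g
  distance≡ = begin
    + (∣ L ─ A ∣ ⊓ ∣ A ─ L ∣)   ≡⟨ ≡.cong +_ (≡.cong₂ _⊓_ ∣L─A∣≡v∸g ∣A─L∣≡k∸g) ⟩
    + ((v ℕ.∸ g) ⊓ (k ℕ.∸ g))   ≡⟨ ≡.cong +_ (ℕ.∸-distribʳ-⊓ g v k) ⟨
    + (v ⊓ k ℕ.∸ g)             ≡⟨ ℤ.⊖-≥ g≤v⊓k ⟨
    (v ⊓ k) ℤ.⊖ g               ≡⟨ ℤ.m-n≡m⊖n (v ⊓ k) g ⟨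
    + (v ⊓ k) - + g             ∎
    where open ≡.≡-Reasoning

module JohnsonGraphCode {c ℓ} (F : Field c ℓ) where
  open Field F hiding (zero; _-_)
  open LinAlg F
  open ExteriorAlgebra commutativeRing
  open Plücker F
  open import Algebra.Properties.Semiring.Sum semiring using (sum; sum-cong-≋; *-distribˡ-sum)
  open import Relation.Binary.Reasoning.Setoid setoid

  module SubspaceClosure {a p} {I : Set a} {C : Vector I → Set p} (C-subspace : IsSubspace C) where

    closed-≋ : ∀ {x y} → x ≋ y → C x → C y
    closed-≋ x≋y Cx = proj₁ C-subspace _ _ Cx x≋y

    closed-𝟎 : C 𝟎
    closed-𝟎 = proj₁ (proj₂ C-subspace)

    closed-⊕ : ∀ {x y} → C x → C y → C (x ⊕ y)
    closed-⊕ = proj₁ (proj₂ (proj₂ C-subspace)) _ _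

    closed-· : ∀ s {x} → C x → C (s · x)
    closed-· s = proj₂ (proj₂ (proj₂ C-subspace)) s _

    closed-sum : ∀ {m} (f : Fin m → Vector I) → (∀ i → C (f i)) → C (λ x → sum λ i → f i x)
    closed-sum {zero}  f Cf = closed-𝟎
    closed-sum {suc m} f Cf = closed-⊕ (Cf zero) (closed-sum (f ∘ suc) (Cf ∘ suc))

    closed-∑ₛ : ∀ {m} (f : Subset m → Vector I) → (∀ K → C (f K)) → C (λ x → ∑ₛ λ K → f K x)
    closed-∑ₛ {zero}  f Cf = Cf []
    closed-∑ₛ {suc m} f Cf = closed-⊕ (closed-∑ₛ (f ∘ (inside ∷_)) (Cf ∘ (inside ∷_)))
                                      (closed-∑ₛ (f ∘ (outside ∷_)) (Cf ∘ (outside ∷_)))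

  SpanDets-isSubspace : ∀ {p n} v (C₀ : Vector (Fin n) → Set p) t → IsSubspace (SpanDets v C₀ t)
  SpanDets-isSubspace {n = n} v C₀ t = closed-≋ , closed-𝟎 , closed-⊕ , closed-·
    where
    closed-≋ : ∀ x y → SpanDets v C₀ t x → x ≋ y → SpanDets v C₀ t y
    closed-≋ x y (m , a , Ms , rows , x≈) x≋y = m , a , Ms , rows , λ L → trans (sym (x≋y L)) (x≈ L)

    closed-𝟎 : SpanDets v C₀ t 𝟎
    closed-𝟎 = 0 , (λ ()) , (λ ()) , (λ ()) , λ L → refl

    closed-⊕ : ∀ x y → SpanDets v C₀ t x → SpanDets v C₀ t y → SpanDets v C₀ t (x ⊕ y)
    closed-⊕ x y (m₁ , a₁ , Ms₁ , rows₁ , x≈) (m₂ , a₂ , Ms₂ , rows₂ , y≈) =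
      m₁ ℕ.+ m₂ , proj₁ ∘ terms , proj₂ ∘ terms , ++⁺ (AtLeastRowsIn C₀ t ∘ proj₂) rows₁ rows₂ ,
      λ L → begin
        x L + y L                                            ≈⟨ +-cong (x≈ L) (y≈ L) ⟩
        sumFin (term L ∘ terms₁) + sumFin (term L ∘ terms₂)
          ≡⟨ ≡.cong₂ _+_ (sumFin≡sum (term L ∘ terms₁)) (sumFin≡sum (term L ∘ terms₂)) ⟩
        sum (term L ∘ terms₁) + sum (term L ∘ terms₂)        ≈⟨ sum-++ (term L) terms₁ terms₂ ⟨
        sum (term L ∘ terms)                                 ≡⟨ sumFin≡sum (term L ∘ terms) ⟨
        sumFin (term L ∘ terms)                              ∎
      where
      term : J n v → Carrier × Matrix v n → Carrier
      term L (a , M) = a * π M L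
      terms₁ : Fin m₁ → Carrier × Matrix v n
      terms₁ i = a₁ i , Ms₁ i
      terms₂ : Fin m₂ → Carrier × Matrix v n
      terms₂ i = a₂ i , Ms₂ i
      terms : Fin (m₁ ℕ.+ m₂) → Carrier × Matrix v n
      terms = terms₁ ++ terms₂

    closed-· : ∀ s x → SpanDets v C₀ t x → SpanDets v C₀ t (s · x)
    closed-· s x (m , a , Ms , rows , x≈) = m , s · a , Ms , rows ,
      λ L → begin
        s * x L                                    ≈⟨ *-congˡ (x≈ L) ⟩
        s * sumFin (λ i → a i * π (Ms i) L)        ≡⟨ ≡.cong (s *_) (sumFin≡sum (λ i → a i * π (Ms i) L)) ⟩
        s * sum (λ i → a i * π (Ms i) L)           ≈⟨ *-distribˡ-sum s (λ i → a i * π (Ms i) L) ⟩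
        sum (λ i → s * (a i * π (Ms i) L))         ≈⟨ sum-cong-≋ (λ i → *-assoc s (a i) _) ⟨
        sum (λ i → s * a i * π (Ms i) L)           ≡⟨ sumFin≡sum (λ i → s * a i * π (Ms i) L) ⟨
        sumFin (λ i → s * a i * π (Ms i) L)        ∎

  module _ {p n} (C₀ : Vector (Fin n) → Set p) (C₀-subspace : IsSubspace C₀) (A : Subset n)
           (A-information : IsInformationSet C₀ (_∈ A)) where
    open SubspaceClosure C₀-subspace

    g : Fin n → V n
    g i = proj₁ (proj₂ A-information (δ i))

    g∈C₀ : ∀ i → C₀ (g i)
    g∈C₀ i = proj₁ (proj₂ (proj₂ A-information (δ i)))

    g≈δ-on-A : ∀ i j → j ∈ A → g i j ≈ δ i j
    g≈δ-on-A i = proj₂ (proj₂ (proj₂ A-information (δ i)))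

    u : Fin n → V n
    u i = if does (i ∈? A) then g i else δ i

    u≈δ-on-A : ∀ i j → j ∈ A → u i j ≈ δ i j
    u≈δ-on-A i j j∈A with i ∈? A
    ... | yes _ = g≈δ-on-A i j j∈A
    ... | no  _ = refl

    u≋δ-off-A : ∀ i → i ∉ A → u i ≋ δ i
    u≋δ-off-A i i∉A with i ∈? A
    ... | yes i∈A = contradiction i∈A i∉A
    ... | no  _   = λ _ → refl

    u∈C₀ : ∀ i → i ∈ A → C₀ (u i)
    u∈C₀ i i∈A with i ∈? A
    ... | yes _   = g∈C₀ i
    ... | no  i∉A = contradiction i∈A i∉A

    open Adapted A u u≈δ-on-A u≋δ-off-A

    C₀-expansion : ∀ {w} → C₀ w → w ≋ lincomb (restrict w)
    C₀-expansion {w} w∈C₀ = proj₁ A-information w (lincomb (restrict w)) w∈C₀ (closed-sum _ term∈C₀)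
      λ j j∈A → sym (trans (lincomb-on-A (restrict w) j j∈A) (restrict-on-A w j j∈A))
      where
      term∈C₀ : ∀ i → C₀ (restrict w i · u i)
      term∈C₀ i = by-membership (i ∈? A)
        where
        by-membership : Dec (i ∈ A) → C₀ (restrict w i · u i)
        by-membership (yes i∈A) = closed-· (restrict w i) (u∈C₀ i i∈A)
        by-membership (no  i∉A) = closed-≋ (λ j → sym (trans (*-congʳ (restrict-off-A w i i∉A)) (zeroˡ _))) closed-𝟎

    rows-avoiding-first : ∀ {v t} (M : Matrix (suc v) n) (σ : Fin t → Fin (suc v)) → Injective _≡_ _≡_ σ →
                          (∀ i → σ i ≢ zero) → (∀ i → C₀ (M (σ i))) → AtLeastRowsIn C₀ t (M ∘ suc)
    rows-avoiding-first M σ σ-injective σ≢0 σ∈C₀ =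
      (λ i → punchOut (σ≢0 i ∘ ≡.sym)) ,
      (λ {i} {j} eq → σ-injective (Fin.punchOut-injective (σ≢0 i ∘ ≡.sym) (σ≢0 j ∘ ≡.sym) eq)) ,
      λ i → ≡.subst (C₀ ∘ M) (≡.sym (Fin.punchIn-punchOut (σ≢0 i ∘ ≡.sym))) (σ∈C₀ i)

    rows-split : ∀ {v t} (M : Matrix (suc v) n) → AtLeastRowsIn C₀ t M →
                 C₀ (M zero) × AtLeastRowsIn C₀ (ℕ.pred t) (M ∘ suc) ⊎ AtLeastRowsIn C₀ t (M ∘ suc)
    rows-split {t = zero}  M _ = inj₂ ((λ ()) , (λ { {()} }) , λ ())
    rows-split {t = suc t} M (σ , σ-injective , σ∈C₀) with Fin.any? (λ j → σ j Fin.≟ zero)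
    ... | yes (j , σj≡0) = inj₁ (≡.subst (C₀ ∘ M) σj≡0 (σ∈C₀ j) ,
          rows-avoiding-first M (σ ∘ punchIn j) (λ eq → Fin.punchIn-injective j _ _ (σ-injective eq))
            (λ i σ[j+i]≡0 → Fin.punchInᵢ≢i j i (σ-injective (≡.trans σ[j+i]≡0 (≡.sym σj≡0))))
            (σ∈C₀ ∘ punchIn j))
    ... | no  σ≢0 = inj₂ (rows-avoiding-first M σ σ-injective (λ i σi≡0 → σ≢0 (i , σi≡0)) σ∈C₀)

    ⋀-span : ∀ {v t} (M : Matrix v n) → AtLeastRowsIn C₀ t M → InSpan v t (⋀ M)
    ⋀-span {zero}  {zero}  M _       = InSpan-e⊥
    ⋀-span {zero}  {suc t} M (σ , _) with σ zero
    ... | ()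
    ⋀-span {suc v} {t}     M rows with rows-split M rows
    ... | inj₁ (M₀∈C₀ , rows′) = InSpan-mono (t≤1+pred t)
          (InSpan-≋ (∧-cong (C₀-expansion M₀∈C₀) (λ _ → refl))
            (lincomb∧-span-A (restrict (M zero)) (restrict-off-A (M zero)) (⋀-span (M ∘ suc) rows′)))
      where
      t≤1+pred : ∀ t → t ≤ suc (ℕ.pred t)
      t≤1+pred zero    = z≤n
      t≤1+pred (suc t) = ℕ.≤-refl
    ⋀-span {suc v} {t} M rows | inj₂ rows′ with lincomb-surjective (M zero)
    ...   | coeffs , M₀≋ = InSpan-≋ (∧-cong M₀≋ (λ _ → refl)) (lincomb∧-span coeffs (⋀-span (M ∘ suc) rows′))

    SpanDets⇒InSpan : ∀ {v t x} → SpanDets v C₀ t x → ∃ λ a → Supported v t a × ∀ (L : J n v) → x L ≈ W⟨ a ⟩ (proj₁ L)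
    SpanDets⇒InSpan {v} {t} {x} (m , a , Ms , rows , x≈)
      with InSpan-sum (λ i → a i · ⋀ (Ms i)) (λ i → InSpan-· (a i) (⋀-span (Ms i) (rows i)))
    ... | b , b-supp , ∑≋W⟨b⟩ = b , b-supp , λ (L , ∣L∣≡v) → begin
      x (L , ∣L∣≡v)                              ≈⟨ x≈ (L , ∣L∣≡v) ⟩
      sumFin (λ i → a i * π (Ms i) (L , ∣L∣≡v))  ≡⟨ sumFin≡sum (λ i → a i * π (Ms i) (L , ∣L∣≡v)) ⟩
      sum (λ i → a i * π (Ms i) (L , ∣L∣≡v))     ≈⟨ sum-cong-≋ (λ i → *-congˡ (π≈⋀ (Ms i) L ∣L∣≡v)) ⟩
      sum (λ i → a i * ⋀ (Ms i) L)               ≈⟨ ∑≋W⟨b⟩ L ⟩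
      W⟨ b ⟩ L                                   ∎

    W∈SpanDets : ∀ {v t} K → Eligible v t K → SpanDets v C₀ t (λ L → W K (proj₁ L))
    W∈SpanDets {t = t} K (≡.refl , t≤∣A∩K∣) = 1 , (λ _ → 1#) , (λ _ → U) , (λ _ → U-rows) , λ (L , ∣L∣≡∣K∣) → begin
      W K L                   ≈⟨ ⋀-elems u K L ⟨
      ⋀ U L                   ≈⟨ π≈⋀ U L ∣L∣≡∣K∣ ⟨
      π U (L , ∣L∣≡∣K∣)       ≈⟨ *-identityˡ _ ⟨
      1# * π U (L , ∣L∣≡∣K∣)  ≈⟨ +-identityʳ _ ⟨
      1# * π U (L , ∣L∣≡∣K∣) + 0#  ∎
      where
      U : Matrix ∣ K ∣ n
      U = u ∘ lookup (elems K)
      U-rows : AtLeastRowsIn C₀ t U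
      U-rows = (λ j → positions A K (Fin.inject≤ j t≤∣A∩K∣)) ,
               (λ {i} {j} eq → Fin.inject≤-injective _ _ i j (positions-injective A K eq)) ,
               λ j → u∈C₀ _ (positions-∈ A K _)

    isInformationSet : ∀ {v k} t → ∣ A ∣ ≡ k →
                       IsInformationSet (SpanDets v C₀ t) (λ L → InBall (+ (v ⊓ k) - + t) A (proj₁ L))
    isInformationSet {v} {k} t ∣A∣≡k = agreement⇒equality , interpolation
      where
      module SpanDets-closure = SubspaceClosure (SpanDets-isSubspace v C₀ t)
      Ball : J n v → Set
      Ball L = InBall (+ (v ⊓ k) - + t) A (proj₁ L)

      ball⇒eligible : ∀ L → Ball L → Eligible v t (proj₁ L)
      ball⇒eligible (L , ∣L∣≡v) in-ball = ∣L∣≡v , Equivalence.to (InBall⇔ t A L ∣L∣≡v ∣A∣≡k) in-ball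

      eligible⇒ball : ∀ L → Eligible v t (proj₁ L) → Ball L
      eligible⇒ball (L , ∣L∣≡v) (_ , t≤) = Equivalence.from (InBall⇔ t A L ∣L∣≡v ∣A∣≡k) t≤

      agreement⇒equality : ∀ x y → SpanDets v C₀ t x → SpanDets v C₀ t y → (∀ L → Ball L → x L ≈ y L) → x ≋ y
      agreement⇒equality x y x∈ y∈ agree (L , ∣L∣≡v) with SpanDets⇒InSpan x∈ | SpanDets⇒InSpan y∈
      ... | a , a-supp , x≈W⟨a⟩ | b , b-supp , y≈W⟨b⟩ = begin
        x (L , ∣L∣≡v)  ≈⟨ x≈W⟨a⟩ (L , ∣L∣≡v) ⟩
        W⟨ a ⟩ L       ≈⟨ ∑ₛ-cong (λ K → *-congʳ (a≋b K)) ⟩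
        W⟨ b ⟩ L       ≈⟨ y≈W⟨b⟩ (L , ∣L∣≡v) ⟨
        y (L , ∣L∣≡v)  ∎
        where
        a≋b : a ≋ b
        a≋b = W⟨⟩-injective a b a-supp b-supp λ L′ (∣L′∣≡v , t≤) →
          trans (sym (x≈W⟨a⟩ (L′ , ∣L′∣≡v)))
                (trans (agree (L′ , ∣L′∣≡v) (eligible⇒ball (L′ , ∣L′∣≡v) (∣L′∣≡v , t≤))) (y≈W⟨b⟩ (L′ , ∣L′∣≡v)))

      extension : (J n v → Carrier) → Λ n
      extension f L = extend (∣ L ∣ ℕ.≟ v)
        where
        extend : Dec (∣ L ∣ ≡ v) → Carrier
        extend (yes ∣L∣≡v) = f (L , ∣L∣≡v)
        extend (no  _)     = 0#

      extension-extends : ∀ f L → extension f (proj₁ L) ≈ f L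
      extension-extends f (L , ∣L∣≡v) with ∣ L ∣ ℕ.≟ v
      ... | yes ∣L∣≡v′ = reflexive (≡.cong (λ eq → f (L , eq)) (ℕ.≡-irrelevant ∣L∣≡v′ ∣L∣≡v))
      ... | no  ∣L∣≢v  = contradiction ∣L∣≡v ∣L∣≢v

      interpolation : ∀ f → ∃ λ x → SpanDets v C₀ t x × (∀ L → Ball L → x L ≈ f L)
      interpolation f with W⟨⟩-interpolates v t (extension f)
      ... | a , a-supp , W⟨a⟩≈f̂ = (λ L → W⟨ a ⟩ (proj₁ L)) , SpanDets-closure.closed-∑ₛ _ term∈SpanDets ,
            λ L in-ball → trans (W⟨a⟩≈f̂ (proj₁ L) (ball⇒eligible L in-ball)) (extension-extends f L)
        where
        term∈SpanDets : ∀ K → SpanDets v C₀ t (λ L → a K * W K (proj₁ L))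
        term∈SpanDets K = by-eligibility (eligible? v t K)
          where
          by-eligibility : Dec (Eligible v t K) → SpanDets v C₀ t (λ L → a K * W K (proj₁ L))
          by-eligibility (yes K-eligible) = SpanDets-closure.closed-· (a K) (W∈SpanDets K K-eligible)
          by-eligibility (no  ¬eligible)  = SpanDets-closure.closed-≋
            (λ L → sym (trans (*-congʳ (a-supp K ¬eligible)) (zeroˡ _))) SpanDets-closure.closed-𝟎

proposition16 : ∀ {c ℓ p : Level} (F : Field c ℓ) (n v k t : ℕ) → 1 ≤ v → v ≤ n
    → (C₀ : LinAlg.Vector F (Fin n) → Set p) → LinAlg.IsMDS F C₀ k
    → LinAlg.IsJGC F n v k ((+ (v ⊓ k)) - (+ t)) (LinAlg.SpanDets F v C₀ t)
proposition16 F n v k t _ _ C₀ (C₀-subspace , _ , C₀-MDS) =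
  SpanDets-isSubspace v C₀ t , λ A ∣A∣≡k → isInformationSet C₀ C₀-subspace A (C₀-MDS A ∣A∣≡k) t ∣A∣≡k
  where open JohnsonGraphCode F
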